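{- Let $\alpha=(\alpha_1,\dots,\alpha_k)$ be a composition of $n$ and let $m\ge1$. For $i\ge1$ let $m_i(\alpha)$ be the number of parts of $\alpha$ equal to $i$. For $\sigma\in S_n$ written in one-line notation, let $\sigma^1,\dots,\sigma^k$ be the consecutive subwords of lengths $\alpha_1,\dots,\alpha_k$, and let $\max(\sigma^j)$ be the largest entry of $\sigma^j$. Then $$\Psi_{\alpha}(x_1,\dots,x_m)=\frac{\prod_{i=1}^n m_i(\alpha)!}{n!}\sum_{\sigma\in S_n}\ \sum_{\substack{1\le i_1\le\cdots\le i_k\le m\\ i_j=i_{j+1}\Rightarrow \max(\sigma^j)<\max(\sigma^{j+1})}} x_{i_1}^{\alpha_1}\cdots x_{i_k}^{\alpha_k}.$$
   Context: A composition of $n$ is a sequence of positive integers with sum $n$; $\ell(\alpha)$ is its number of parts. $\alpha\preccurlyeq\beta$ ($\alpha$ refines $\beta$, also written $\beta\succcurlyeq\alpha$) means $\beta$ is obtained from $\alpha$ by summing consecutive blocks of parts; $\alpha^{(i)}$ is the block of parts of $\alpha$ summing to $\beta_i$. The monomial quasisymmetric function is $M_\beta=\sum_{i_1<\cdots<i_r}x_{i_1}^{\beta_1}\cdots x_{i_r}^{\beta_r}$ for $\beta=(\beta_1,\dots,\beta_r)$. For a composition $\gamma$, $\pi(\gamma)=\prod_{i=1}^{\ell(\gamma)}(\gamma_1+\cdots+\gamma_i)$, and for $\alpha\preccurlyeq\beta$, $\pi(\alpha,\beta)=\prod_{i=1}^{\ell(\beta)}\pi(\alpha^{(i)})$. $z_\alpha=\prod_i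 i^{m_i(\alpha)}m_i(\alpha)!$. The type 1 quasisymmetric power sum is $\Psi_\alpha=z_\alpha\sum_{\beta\succcurlyeq\alpha}\frac{1}{\pi(\alpha,\beta)}M_\beta$, and $\Psi_\alpha(x_1,\dots,x_m)$ denotes its specialization with $x_i=0$ for $i>m$. -}

module Defs where

open import Data.Bool using (Bool; true; false; _∧_; _∨_; not; if_then_else_)
open import Data.Nat as ℕ using (ℕ; zero; suc; _⊔_; _^_; _≡ᵇ_; _<ᵇ_)
open import Data.Nat using (_!)
open import Data.Nat.ListAction using (sum; product)
open import Data.Integer using (+_)
open import Data.Fin using (Fin; toℕ)
open import Data.List using (List; []; _∷_; map; concatMap; filter; foldr; length; take; drop; upTo; allFin; zip)
open import Data.Vec using (Vec; replicate; updateAt)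
open import Data.Vec.Properties using (≡-dec)
open import Data.Product using (_×_; _,_; proj₁; proj₂)
open import Data.Rational using (ℚ; 0ℚ; _/_)
import Data.Rational as Q
open import Relation.Nullary.Decidable using (⌊_⌋)
open import Relation.Unary using (Decidable)
open import Data.List.Relation.Unary.AllPairs using (AllPairs)
open import Data.List.Relation.Unary.AllPairs.Properties using ()
import Data.List.Relation.Unary.AllPairs as AP
open import Relation.Nullary using (¬_)
open import Relation.Binary.PropositionalEquality using (_≡_)
import Data.Nat.Properties as NP

ℕ→ℚ : ℕ → ℚ
ℕ→ℚ k = (+ k) / 1

-- 1/k for k > 0 (junk value 0 at k = 0; only used at nonzero k)
inv : ℕ → ℚ
inv zero    = 0ℚ
inv (suc k) = (+ 1) / suc k

sumℚ : List ℚ → ℚ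
sumℚ = foldr Q._+_ 0ℚ

-- Polynomials in x_0 , … , x_{m-1} (variables indexed by Fin m) with
-- rational coefficients, as finite formal sums of terms c · x^e.
-- Two polynomials are equal iff all their coefficients agree.

Poly : ℕ → Set
Poly m = List (ℚ × Vec ℕ m)

coeff : ∀ {m} → Poly m → Vec ℕ m → ℚ
coeff p e = sumℚ (map proj₁ (filter (λ t → ≡-dec NP._≟_ (proj₂ t) e) p))

_≈P_ : ∀ {m} → Poly m → Poly m → Set
p ≈P q = ∀ e → coeff p e ≡ coeff q e

-- exponent vector of x_{i_1}^{a_1} ⋯ x_{i_k}^{a_k}
mono : ∀ {m} → List (Fin m) → List ℕ → Vec ℕ m
mono {m} [] _ = replicate m 0
mono (i ∷ is) [] = mono is []
mono (i ∷ is) (a ∷ as) = updateAt (mono is as) i (a ℕ.+_)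

allSeqs : (k m : ℕ) → List (List (Fin m))
allSeqs zero    m = [] ∷ []
allSeqs (suc k) m = concatMap (λ i → map (i ∷_) (allSeqs k m)) (allFin m)

strictInc : ∀ {m} → List (Fin m) → Bool
strictInc [] = true
strictInc (i ∷ []) = true
strictInc (i ∷ j ∷ is) = (toℕ i <ᵇ toℕ j) ∧ strictInc (j ∷ is)

mult : ℕ → List ℕ → ℕ
mult i α = length (filter (λ a → a NP.≟ i) α)

-- z_α = ∏_{i=1}^{n} i^{m_i(α)} m_i(α)!   (n = |α|; parts are ≤ n)
zee : List ℕ → ℕ
zee α = product (map (λ i → (i ^ mult i α) ℕ.* (mult i α !)) (map suc (upTo (sum α))))

multFact : List ℕ → ℕ
multFact α = product (map (λ i → mult i α !) (map suc (upTo (sum α))))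

partialSums : List ℕ → List ℕ
partialSums [] = []
partialSums (g ∷ gs) = g ∷ map (g ℕ.+_) (partialSums gs)

πc : List ℕ → ℕ
πc γ = product (partialSums γ)

-- All ways of cutting α into consecutive nonempty blocks
-- α = α^(1) ⋯ α^(r); these correspond bijectively to the
-- compositions β ≽ α (β_i = |α^(i)|).
blockings : List ℕ → List (List (List ℕ))
blockings [] = [] ∷ []
blockings (a ∷ as) = concatMap ext (blockings as)
  where
  ext : List (List ℕ) → List (List (List ℕ))
  ext [] = ((a ∷ []) ∷ []) ∷ []
  ext (b ∷ bs) = ((a ∷ []) ∷ b ∷ bs) ∷ ((a ∷ b) ∷ bs) ∷ []

Mpoly : (m : ℕ) → List ℕ → Poly m
Mpoly m β = map (λ is → (Q.1ℚ , mono is β)) (filter (λ is → strictInc is Data.Bool.≟ true) (allSeqs (length β) m))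
  where import Data.Bool

scaleP : ∀ {m} → ℚ → Poly m → Poly m
scaleP c = map (λ t → (c Q.* proj₁ t , proj₂ t))

-- Ψ_α(x_0, …, x_{m-1}) = z_α Σ_{β ≽ α} (1/π(α,β)) M_β
Psi : (m : ℕ) → List ℕ → Poly m
Psi m α = concatMap term (blockings α)
  where
  term : List (List ℕ) → Poly m
  term bs = scaleP (ℕ→ℚ (zee α) Q.* inv (product (map πc bs))) (Mpoly m (map sum bs))

-- Permutations of [n] in one-line notation: words of length n over
-- {1, …, n} with no repeated letter.

allWords : (k : ℕ) → List ℕ → List (List ℕ)
allWords zero    A = [] ∷ []
allWords (suc k) A = concatMap (λ a → map (a ∷_) (allWords k A)) A

perms : ℕ → List (List ℕ)
perms n = filter (AP.allPairs? (λ x y → Relation.Nullary.¬? (x NP.≟ y))) (allWords n (map suc (upTo n)))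
  where import Relation.Nullary

subwords : List ℕ → List ℕ → List (List ℕ)
subwords [] σ = []
subwords (a ∷ α) σ = take a σ ∷ subwords α (drop a σ)

maxL : List ℕ → ℕ
maxL = foldr _⊔_ 0

admissible : ∀ {m} → List (Fin m × ℕ) → Bool
admissible [] = true
admissible (_ ∷ []) = true
admissible ((i , a) ∷ (j , b) ∷ rest) =
  ((toℕ i ℕ.≤ᵇ toℕ j) ∧ (not (toℕ i ≡ᵇ toℕ j) ∨ (a <ᵇ b)))
  ∧ admissible ((j , b) ∷ rest)

RHS : (m : ℕ) → List ℕ → Poly m
RHS m α = scaleP (ℕ→ℚ (multFact α) Q.* inv (sum α !)) (concatMap inner (perms (sum α)))
  where
  import Data.Bool
  inner : List ℕ → Poly m
  inner σ = map (λ is → (Q.1ℚ , mono is α))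
    (filter (λ is → admissible (zip is (map maxL (subwords α σ))) Data.Bool.≟ true)
            (allSeqs (length α) m))

module Submission where

-- A coarsening β ≽ α is encoded by a flagging S of the parts of α (a part is
-- flagged when it is glued to its predecessor).  Grouping the equal
-- consecutive indices of an admissible sequence i_1 ≤ ⋯ ≤ i_k yields a
-- flagging S and a strictly increasing sequence for β(S); admissibility says
-- that the subword maxima of σ rise across every glued pair.  So the right
-- side is (∏ m_i(α)! / n!) Σ_S count(S) · M_{β(S)}, where count(S) counts the
-- permutations with that property.  The counting theorem
-- count(S) · π(α, β) = n! · ∏ α (induction on n, inserting the largest letter)
-- and z_α = (∏ m_i(α)!) · ∏ α turn this weight into z_α / π(α, β).

open import Defs
open import Data.Bool using (Bool; true; false; _∧_; _∨_; not; if_then_else_)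
open import Data.Bool.Properties using (∨-zeroʳ)
import Data.Bool as Bool
open import Data.Nat using (ℕ; zero; suc; _+_; _*_; _^_; _≤_; _<_; z≤n; s≤s; s≤s⁻¹; z<s; _⊔_; _<ᵇ_; _≤ᵇ_; _≡ᵇ_; _!; >-nonZero; >-nonZero⁻¹)
open import Data.Nat.Properties
open import Data.Nat.ListAction using (sum; product)
open import Data.Nat.ListAction.Properties using (product-++; product≢0)
open import Data.Nat.Solver using (module +-*-Solver)
open import Data.Fin using (Fin; toℕ) renaming (zero to fzero; suc to fsuc)
open import Data.Vec using (Vec; updateAt; replicate)
open import Data.Vec.Properties using (≡-dec; updateAt-updateAt-local)
open import Data.List using (List; []; _∷_; [_]; _++_; map; concatMap; filter; length; take; drop; upTo; allFin; zip)
import Data.List.Properties as ListP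
open import Data.List.Relation.Unary.All using (All; []; _∷_)
import Data.List.Relation.Unary.All as All
import Data.List.Relation.Unary.All.Properties as AllP
open import Data.List.Relation.Unary.Any using (Any; here; there)
import Data.List.Relation.Unary.AllPairs as AllPairs
open import Data.Product using (_×_; _,_; proj₁; proj₂)
open import Data.Sum using (_⊎_; inj₁; inj₂)
open import Relation.Nullary using (Dec; does; ¬_; ¬?)
open import Relation.Nullary.Decidable using (dec-true; dec-false)
open import Relation.Unary using (Decidable)
open import Relation.Binary.PropositionalEquality hiding ([_])
import Data.Integer as ℤ
import Data.Integer.Properties as ℤP
import Data.Integer.Solver
import Data.Rational.Solver
import Data.Rational as Q
open Q using (ℚ)
import Data.Rational.Properties as QP
import Data.Rational.Unnormalised as U
import Data.Rational.Unnormalised.Properties as UP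
open +-*-Solver using (solve; _:+_; _:*_; _:=_; con)
module ℤS = Data.Integer.Solver.+-*-Solver
module ℚS = Data.Rational.Solver.+-*-Solver

private variable A B : Set

-- The Iverson bracket: 𝟙 b is 1 when b holds and 0 otherwise.  Every
-- filtered count below is rewritten as an unfiltered sum of brackets.
𝟙 : Bool → ℕ
𝟙 true  = 1
𝟙 false = 0

𝟙-∧ : ∀ a b → 𝟙 (a ∧ b) ≡ 𝟙 a * 𝟙 b
𝟙-∧ true  b = sym (+-identityʳ (𝟙 b))
𝟙-∧ false b = refl

∑ : List A → (A → ℕ) → ℕ
∑ []       f = 0
∑ (x ∷ xs) f = f x + ∑ xs f

∑-++ : (xs ys : List A) (f : A → ℕ) → ∑ (xs ++ ys) f ≡ ∑ xs f + ∑ ys f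
∑-++ []       ys f = refl
∑-++ (x ∷ xs) ys f = trans (cong (f x +_) (∑-++ xs ys f)) (sym (+-assoc (f x) _ _))

∑-cong : (xs : List A) {f g : A → ℕ} → (∀ x → f x ≡ g x) → ∑ xs f ≡ ∑ xs g
∑-cong []       eq = refl
∑-cong (x ∷ xs) eq = cong₂ _+_ (eq x) (∑-cong xs eq)

∑-congAll : ∀ {P : A → Set} (xs : List A) {f g : A → ℕ} →
            All P xs → (∀ x → P x → f x ≡ g x) → ∑ xs f ≡ ∑ xs g
∑-congAll []       []         eq = refl
∑-congAll (x ∷ xs) (px ∷ pxs) eq = cong₂ _+_ (eq x px) (∑-congAll xs pxs eq)

∑-congMem : (xs : List A) {f g : A → ℕ} → (∀ x → Any (x ≡_) xs → f x ≡ g x) → ∑ xs f ≡ ∑ xs g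
∑-congMem []       eq = refl
∑-congMem (x ∷ xs) eq = cong₂ _+_ (eq x (here refl)) (∑-congMem xs (λ y y∈xs → eq y (there y∈xs)))

∑-zero : (xs : List A) → ∑ xs (λ _ → 0) ≡ 0
∑-zero []       = refl
∑-zero (x ∷ xs) = ∑-zero xs

∑-+ : (xs : List A) (f g : A → ℕ) → ∑ xs (λ x → f x + g x) ≡ ∑ xs f + ∑ xs g
∑-+ []       f g = refl
∑-+ (x ∷ xs) f g = trans (cong (f x + g x +_) (∑-+ xs f g))
  (solve 4 (λ a b c d → (a :+ b) :+ (c :+ d) := (a :+ c) :+ (b :+ d)) refl (f x) (g x) (∑ xs f) (∑ xs g))

∑-*ˡ : (xs : List A) (c : ℕ) (f : A → ℕ) → ∑ xs (λ x → c * f x) ≡ c * ∑ xs f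
∑-*ˡ []       c f = sym (*-zeroʳ c)
∑-*ˡ (x ∷ xs) c f = trans (cong (c * f x +_) (∑-*ˡ xs c f)) (sym (*-distribˡ-+ c (f x) (∑ xs f)))

∑-*ʳ : (xs : List A) (c : ℕ) (f : A → ℕ) → ∑ xs (λ x → f x * c) ≡ ∑ xs f * c
∑-*ʳ xs c f = trans (∑-cong xs (λ x → *-comm (f x) c)) (trans (∑-*ˡ xs c f) (*-comm c _))

∑-filter : ∀ {P : A → Set} (P? : Decidable P) (xs : List A) (f : A → ℕ) →
           ∑ (filter P? xs) f ≡ ∑ xs (λ x → 𝟙 (does (P? x)) * f x)
∑-filter P? []       f = refl
∑-filter P? (x ∷ xs) f with does (P? x)
... | false = ∑-filter P? xs f
... | true  = cong₂ _+_ (sym (+-identityʳ (f x))) (∑-filter P? xs f)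

∑-map : (g : A → B) (xs : List A) (f : B → ℕ) → ∑ (map g xs) f ≡ ∑ xs (λ x → f (g x))
∑-map g []       f = refl
∑-map g (x ∷ xs) f = cong (f (g x) +_) (∑-map g xs f)

∑-concatMap : (g : A → List B) (xs : List A) (f : B → ℕ) →
              ∑ (concatMap g xs) f ≡ ∑ xs (λ x → ∑ (g x) f)
∑-concatMap g []       f = refl
∑-concatMap g (x ∷ xs) f = trans (∑-++ (g x) (concatMap g xs) f) (cong (∑ (g x) f +_) (∑-concatMap g xs f))

∑-swap : (xs : List A) (ys : List B) (f : A → B → ℕ) →
         ∑ xs (λ x → ∑ ys (f x)) ≡ ∑ ys (λ y → ∑ xs (λ x → f x y))
∑-swap []       ys f = sym (∑-zero ys)
∑-swap (x ∷ xs) ys f = trans (cong (∑ ys (f x) +_) (∑-swap xs ys f)) (sym (∑-+ ys (f x) (λ y → ∑ xs (λ x → f x y))))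

∑-swap-weighted : (xs : List A) (ys : List B) (u : A → ℕ) (v : B → ℕ) (f : A → B → ℕ) →
  ∑ xs (λ x → u x * ∑ ys (λ y → v y * f x y)) ≡ ∑ ys (λ y → v y * ∑ xs (λ x → u x * f x y))
∑-swap-weighted xs ys u v f = begin
    ∑ xs (λ x → u x * ∑ ys (λ y → v y * f x y))
  ≡⟨ ∑-cong xs (λ x → sym (∑-*ˡ ys (u x) _)) ⟩
    ∑ xs (λ x → ∑ ys (λ y → u x * (v y * f x y)))
  ≡⟨ ∑-swap xs ys _ ⟩
    ∑ ys (λ y → ∑ xs (λ x → u x * (v y * f x y)))
  ≡⟨ ∑-cong ys (λ y → trans (∑-cong xs (λ x → solve 3 (λ a b c → a :* (b :* c) := b :* (a :* c)) refl (u x) (v y) (f x y)))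
                            (∑-*ˡ xs (v y) _)) ⟩
    ∑ ys (λ y → v y * ∑ xs (λ x → u x * f x y))
  ∎ where open ≡-Reasoning

∑< : ℕ → (ℕ → ℕ) → ℕ
∑< zero    f = 0
∑< (suc n) f = f 0 + ∑< n (λ i → f (suc i))

∑<-+ : ∀ a b f → ∑< (a + b) f ≡ ∑< a f + ∑< b (λ q → f (a + q))
∑<-+ zero    b f = refl
∑<-+ (suc a) b f = trans (cong (f 0 +_) (∑<-+ a b (λ i → f (suc i)))) (sym (+-assoc (f 0) _ _))

∑<-cong : ∀ n {f g} → (∀ i → i < n → f i ≡ g i) → ∑< n f ≡ ∑< n g
∑<-cong zero    eq = refl
∑<-cong (suc n) eq = cong₂ _+_ (eq 0 z<s) (∑<-cong n (λ i i<n → eq (suc i) (s≤s i<n)))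

∑<-const : ∀ n c → ∑< n (λ _ → c) ≡ n * c
∑<-const zero    c = refl
∑<-const (suc n) c = cong (c +_) (∑<-const n c)

∑<-*ˡ : ∀ n a h → ∑< n (λ p → a * h p) ≡ a * ∑< n h
∑<-*ˡ zero    a h = sym (*-zeroʳ a)
∑<-*ˡ (suc n) a h = trans (cong (a * h 0 +_) (∑<-*ˡ n a (λ p → h (suc p)))) (sym (*-distribˡ-+ a _ _))

∑-bracket : (xs : List A) (b : Bool) (c : A → Bool) (h : A → ℕ) →
            ∑ xs (λ x → 𝟙 (b ∧ c x) * h x) ≡ 𝟙 b * ∑ xs (λ x → 𝟙 (c x) * h x)
∑-bracket xs b c h =
  trans (∑-cong xs (λ x → trans (cong (_* h x) (𝟙-∧ b (c x))) (*-assoc (𝟙 b) (𝟙 (c x)) (h x))))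
        (∑-*ˡ xs (𝟙 b) (λ x → 𝟙 (c x) * h x))

distinct? : (w : List ℕ) → Dec (AllPairs.AllPairs (λ x y → ¬ x ≡ y) w)
distinct? = AllPairs.allPairs? (λ x y → ¬? (x ≟ y))

distinct : List ℕ → Bool
distinct w = does (distinct? w)

notIn : ℕ → List ℕ → Bool
notIn x w = does (All.all? (λ y → ¬? (x ≟ y)) w)

remove : ℕ → List ℕ → List ℕ
remove x A = filter (λ y → ¬? (x ≟ y)) A

insertAt : ℕ → ℕ → List ℕ → List ℕ
insertAt zero    c τ       = c ∷ τ
insertAt (suc p) c []      = c ∷ []
insertAt (suc p) c (x ∷ τ) = x ∷ insertAt p c τ

∑dist : ℕ → List ℕ → (List ℕ → ℕ) → ℕ
∑dist k A f = ∑ (allWords k A) (λ w → 𝟙 (distinct w) * f w)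

prefixed : ℕ → (List ℕ → ℕ) → List ℕ → ℕ
prefixed y f w = 𝟙 (notIn y w) * f (y ∷ w)

∑-allWords-suc : ∀ k A (F : List ℕ → ℕ) → ∑ (allWords (suc k) A) F ≡ ∑ A (λ y → ∑ (allWords k A) (λ w → F (y ∷ w)))
∑-allWords-suc k A F = trans (∑-concatMap _ A F) (∑-cong A (λ y → ∑-map (y ∷_) (allWords k A) F))

∑dist-suc : ∀ k A f → ∑dist (suc k) A f ≡ ∑ A (λ y → ∑dist k A (prefixed y f))
∑dist-suc k A f = trans (∑-allWords-suc k A _) (∑-cong A (λ y → ∑-cong (allWords k A) (reorder y)))
  where
  reorder : ∀ y w → 𝟙 (notIn y w ∧ distinct w) * f (y ∷ w) ≡ 𝟙 (distinct w) * prefixed y f w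
  reorder y w = trans (cong (_* f (y ∷ w)) (𝟙-∧ (notIn y w) (distinct w)))
    (solve 3 (λ n d v → n :* d :* v := d :* (n :* v)) refl (𝟙 (notIn y w)) (𝟙 (distinct w)) (f (y ∷ w)))

∑-notIn : ∀ k A x (g : List ℕ → ℕ) →
          ∑ (allWords k A) (λ w → 𝟙 (notIn x w) * g w) ≡ ∑ (allWords k (remove x A)) g
∑-notIn zero    A x g = cong (_+ 0) (*-identityˡ (g []))
∑-notIn (suc k) A x g = begin
    ∑ (allWords (suc k) A) (λ w → 𝟙 (notIn x w) * g w)
  ≡⟨ ∑-allWords-suc k A _ ⟩
    ∑ A (λ y → ∑ (allWords k A) (λ w → 𝟙 (does (¬? (x ≟ y)) ∧ notIn x w) * g (y ∷ w)))
  ≡⟨ ∑-cong A split ⟩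
    ∑ A (λ y → 𝟙 (does (¬? (x ≟ y))) * ∑ (allWords k (remove x A)) (λ w → g (y ∷ w)))
  ≡⟨ sym (∑-filter _ A _) ⟩
    ∑ (remove x A) (λ y → ∑ (allWords k (remove x A)) (λ w → g (y ∷ w)))
  ≡⟨ sym (∑-allWords-suc k (remove x A) g) ⟩
    ∑ (allWords (suc k) (remove x A)) g
  ∎
  where
  open ≡-Reasoning
  split : ∀ y → ∑ (allWords k A) (λ w → 𝟙 (does (¬? (x ≟ y)) ∧ notIn x w) * g (y ∷ w)) ≡
                𝟙 (does (¬? (x ≟ y))) * ∑ (allWords k (remove x A)) (λ w → g (y ∷ w))
  split y = trans (∑-bracket (allWords k A) (does (¬? (x ≟ y))) (notIn x) (λ w → g (y ∷ w)))
                  (cong (𝟙 (does (¬? (x ≟ y))) *_) (∑-notIn k A x (λ w → g (y ∷ w))))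

∑dist-prefixed : ∀ k A x f → ∑dist k A (prefixed x f) ≡ ∑dist k (remove x A) (λ w → f (x ∷ w))
∑dist-prefixed k A x f = trans (∑-cong (allWords k A) commute) (∑-notIn k A x (λ w → 𝟙 (distinct w) * f (x ∷ w)))
  where
  commute : ∀ w → 𝟙 (distinct w) * prefixed x f w ≡ 𝟙 (notIn x w) * (𝟙 (distinct w) * f (x ∷ w))
  commute w = solve 3 (λ d n v → d :* (n :* v) := n :* (d :* v)) refl (𝟙 (distinct w)) (𝟙 (notIn x w)) (f (x ∷ w))

remove-shrinks : ∀ x A → Any (x ≡_) A → length (remove x A) < length A
remove-shrinks x A x∈A = ListP.filter-notAll (λ y → ¬? (x ≟ y)) A (witness x∈A)
  where
  witness : ∀ {B} → Any (x ≡_) B → Any (λ y → ¬ ¬ (x ≡ y)) B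
  witness (here x≡y) = here (λ x≢y → x≢y x≡y)
  witness (there p)  = there (witness p)

∑dist-overfull : ∀ k A → length A < k → (f : List ℕ → ℕ) → ∑dist k A f ≡ 0
∑dist-overfull (suc k) A |A|≤k f = begin
    ∑dist (suc k) A f
  ≡⟨ ∑dist-suc k A f ⟩
    ∑ A (λ y → ∑dist k A (prefixed y f))
  ≡⟨ ∑-cong A (λ y → ∑dist-prefixed k A y f) ⟩
    ∑ A (λ y → ∑dist k (remove y A) (λ w → f (y ∷ w)))
  ≡⟨ ∑-congMem A (λ y y∈A → ∑dist-overfull k (remove y A)
        (<-≤-trans (remove-shrinks y A y∈A) (s≤s⁻¹ |A|≤k)) _) ⟩
    ∑ A (λ _ → 0)
  ≡⟨ ∑-zero A ⟩
    0
  ∎ where open ≡-Reasoning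

notIn-insertAt : ∀ x c p τ → ¬ x ≡ c → notIn x (insertAt p c τ) ≡ notIn x τ
notIn-insertAt x c zero    τ       x≢c rewrite dec-false (x ≟ c) x≢c = refl
notIn-insertAt x c (suc p) []      x≢c rewrite dec-false (x ≟ c) x≢c = refl
notIn-insertAt x c (suc p) (y ∷ τ) x≢c = cong (does (¬? (x ≟ y)) ∧_) (notIn-insertAt x c p τ x≢c)

remove-snoc : ∀ c A → All (λ y → ¬ y ≡ c) A → remove c (A ++ [ c ]) ≡ A
remove-snoc c A c∉A = begin
    remove c (A ++ [ c ])
  ≡⟨ ListP.filter-++ _ A [ c ] ⟩
    remove c A ++ remove c [ c ]
  ≡⟨ cong₂ _++_ (ListP.filter-all _ (All.map (λ y≢c c≡y → y≢c (sym c≡y)) c∉A)) remove-self ⟩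
    A ++ []
  ≡⟨ ListP.++-identityʳ A ⟩
    A
  ∎ where
  open ≡-Reasoning
  remove-self : remove c [ c ] ≡ []
  remove-self rewrite dec-true (c ≟ c) refl = refl

module _ (A : List ℕ) (c : ℕ) (c∉A : All (λ y → ¬ y ≡ c) A) where

  -- The distinct words of length k over A ∪ {c} that contain c: insert c
  -- into a distinct word of length k - 1 over A at one of k positions.
  withC : ℕ → (List ℕ → ℕ) → ℕ
  withC zero    f = 0
  withC (suc k) f = ∑dist k A (λ τ → ∑< (suc k) (λ p → f (insertAt p c τ)))

  -- Contributions with c in a non-initial position regroup by the first letter.
  withC-prefixed : ∀ k f → ∑ A (λ x → withC k (prefixed x f)) ≡
                   ∑dist k A (λ τ → ∑< k (λ p → f (insertAt (suc p) c τ)))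
  withC-prefixed zero     f = ∑-zero A
  withC-prefixed (suc k′) f = begin
      ∑ A (λ x → ∑dist k′ A (λ τ → ∑< (suc k′) (λ p → prefixed x f (insertAt p c τ))))
    ≡⟨ ∑-congAll A c∉A (λ x x≢c → ∑-cong (allWords k′ A) (λ τ → cong (𝟙 (distinct τ) *_) (pull x x≢c τ))) ⟩
      ∑ A (λ x → ∑dist k′ A (prefixed x (λ τ′ → ∑< (suc k′) (λ p → f (insertAt (suc p) c τ′)))))
    ≡⟨ sym (∑dist-suc k′ A _) ⟩
      ∑dist (suc k′) A (λ τ → ∑< (suc k′) (λ p → f (insertAt (suc p) c τ)))
    ∎ where
    open ≡-Reasoning
    pull : ∀ x → ¬ x ≡ c → ∀ τ → ∑< (suc k′) (λ p → prefixed x f (insertAt p c τ)) ≡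
           prefixed x (λ τ′ → ∑< (suc k′) (λ p → f (insertAt (suc p) c τ′))) τ
    pull x x≢c τ = trans (∑<-cong (suc k′) (λ p _ → cong (λ b → 𝟙 b * f (x ∷ insertAt p c τ)) (notIn-insertAt x c p τ x≢c)))
                         (∑<-*ˡ (suc k′) (𝟙 (notIn x τ)) (λ p → f (x ∷ insertAt p c τ)))

  -- Splitting distinct words over A ∪ {c} by whether they contain c.
  ∑dist-snoc : ∀ k f → ∑dist k (A ++ [ c ]) f ≡ ∑dist k A f + withC k f
  ∑dist-snoc zero    f = sym (+-identityʳ _)
  ∑dist-snoc (suc k) f = begin
      ∑dist (suc k) (A ++ [ c ]) f
    ≡⟨ ∑dist-suc k (A ++ [ c ]) f ⟩
      ∑ (A ++ [ c ]) (λ y → ∑dist k (A ++ [ c ]) (prefixed y f))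
    ≡⟨ ∑-++ A [ c ] (λ y → ∑dist k (A ++ [ c ]) (prefixed y f)) ⟩
      ∑ A (λ x → ∑dist k (A ++ [ c ]) (prefixed x f)) + (∑dist k (A ++ [ c ]) (prefixed c f) + 0)
    ≡⟨ cong₂ _+_ (∑-cong A (λ x → ∑dist-snoc k (prefixed x f))) (trans (+-identityʳ _) startsWithC) ⟩
      ∑ A (λ x → ∑dist k A (prefixed x f) + withC k (prefixed x f)) + ∑dist k A (λ τ → f (c ∷ τ))
    ≡⟨ cong (_+ ∑dist k A (λ τ → f (c ∷ τ))) (∑-+ A _ _) ⟩
      (∑ A (λ x → ∑dist k A (prefixed x f)) + ∑ A (λ x → withC k (prefixed x f))) + ∑dist k A (λ τ → f (c ∷ τ))
    ≡⟨ cong₂ (λ u v → (u + v) + ∑dist k A (λ τ → f (c ∷ τ))) (sym (∑dist-suc k A f)) (withC-prefixed k f) ⟩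
      (∑dist (suc k) A f + ∑dist k A later) + ∑dist k A (λ τ → f (c ∷ τ))
    ≡⟨ +-assoc (∑dist (suc k) A f) _ _ ⟩
      ∑dist (suc k) A f + (∑dist k A later + ∑dist k A (λ τ → f (c ∷ τ)))
    ≡⟨ cong (∑dist (suc k) A f +_) (trans (+-comm (∑dist k A later) _) (sym (∑-+ (allWords k A) _ _))) ⟩
      ∑dist (suc k) A f + ∑ (allWords k A) (λ τ → 𝟙 (distinct τ) * f (c ∷ τ) + 𝟙 (distinct τ) * later τ)
    ≡⟨ cong (∑dist (suc k) A f +_) (∑-cong (allWords k A) (λ τ → sym (*-distribˡ-+ (𝟙 (distinct τ)) _ _))) ⟩
      ∑dist (suc k) A f + withC (suc k) f
    ∎ where
    open ≡-Reasoning
    later : List ℕ → ℕ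
    later τ = ∑< k (λ p → f (insertAt (suc p) c τ))
    startsWithC : ∑dist k (A ++ [ c ]) (prefixed c f) ≡ ∑dist k A (λ τ → f (c ∷ τ))
    startsWithC = trans (∑dist-prefixed k (A ++ [ c ]) c f)
                        (cong (λ B → ∑dist k B (λ τ → f (c ∷ τ))) (remove-snoc c A c∉A))

letters : ℕ → List ℕ
letters n = map suc (upTo n)

letters-suc : ∀ n → letters (suc n) ≡ letters n ++ [ suc n ]
letters-suc n = trans (cong (map suc) (sym (ListP.upTo-∷ʳ n))) (ListP.map-++ suc (upTo n) [ n ])

letters-< : ∀ n → All (_< suc n) (letters n)
letters-< n = AllP.map⁺ (AllP.applyUpTo⁺₁ (λ i → i) n s≤s)

letters-length : ∀ n → length (letters n) ≡ n
letters-length n = trans (ListP.length-map suc (upTo n)) (ListP.length-applyUpTo (λ i → i) n)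

∑-perms-suc : ∀ n (f : List ℕ → ℕ) →
              ∑ (perms (suc n)) f ≡ ∑ (perms n) (λ τ → ∑< (suc n) (λ p → f (insertAt p (suc n) τ)))
∑-perms-suc n f = begin
    ∑ (perms (suc n)) f
  ≡⟨ ∑-filter distinct? (allWords (suc n) (letters (suc n))) f ⟩
    ∑dist (suc n) (letters (suc n)) f
  ≡⟨ cong (λ B → ∑dist (suc n) B f) (letters-suc n) ⟩
    ∑dist (suc n) (letters n ++ [ suc n ]) f
  ≡⟨ ∑dist-snoc (letters n) (suc n) fresh (suc n) f ⟩
    ∑dist (suc n) (letters n) f + withC (letters n) (suc n) fresh (suc n) f
  ≡⟨ cong (_+ withC (letters n) (suc n) fresh (suc n) f)
          (∑dist-overfull (suc n) (letters n) (subst (_< suc n) (sym (letters-length n)) ≤-refl) f) ⟩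
    withC (letters n) (suc n) fresh (suc n) f
  ≡⟨ sym (∑-filter distinct? (allWords n (letters n)) _) ⟩
    ∑ (perms n) (λ τ → ∑< (suc n) (λ p → f (insertAt p (suc n) τ)))
  ∎ where
  open ≡-Reasoning
  fresh : All (λ y → ¬ y ≡ suc n) (letters n)
  fresh = All.map (λ y<n+1 y≡n+1 → <-irrefl y≡n+1 y<n+1) (letters-< n)

allWords-props : ∀ {Q : ℕ → Set} k A → All Q A → All (λ w → length w ≡ k × All Q w) (allWords k A)
allWords-props zero A qA = (refl , []) ∷ []
allWords-props {Q} (suc k) A qA = AllP.concat⁺ (AllP.map⁺ (All.map (λ qy → AllP.map⁺
  (All.map (λ { (len , qw) → cong suc len , qy ∷ qw }) (allWords-props {Q} k A qA))) qA))

perms-props : ∀ n → All (λ w → length w ≡ n × All (_< suc n) w) (perms n)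
perms-props n = AllP.filter⁺ distinct? (allWords-props n (letters n) (letters-< n))

-- A flagged composition lists the parts of α, each with a flag telling
-- whether it is glued to the previous part; the maximal glued runs are the
-- blocks α^(1), …, α^(r) of a coarsening β ≽ α.
Flagged : Set
Flagged = List (ℕ × Bool)

parts : Flagged → List ℕ
parts = map proj₁

Positive : Flagged → Set
Positive S = All (λ a → 0 < a) (parts S)

gluedHead : Flagged → Bool
gluedHead []            = false
gluedHead ((_ , g) ∷ _) = g

blockMaxima : Flagged → List ℕ → List ℕ
blockMaxima S σ = map maxL (subwords (parts S) σ)

-- gluedRise μ S M: the maxima M strictly increase across every glued pair
-- of parts; μ is the maximum attached to the (virtual) part before S.
gluedRise : ℕ → Flagged → List ℕ → Bool
gluedRise μ []            _       = true
gluedRise μ (_ ∷ _)       []      = true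
gluedRise μ ((_ , g) ∷ S) (ν ∷ M) = (not g ∨ (μ <ᵇ ν)) ∧ gluedRise ν S M

gluedRise-unglued : ∀ μ ν S M → gluedHead S ≡ false → gluedRise μ S M ≡ gluedRise ν S M
gluedRise-unglued μ ν []                _       _ = refl
gluedRise-unglued μ ν (_ ∷ _)           []      _ = refl
gluedRise-unglued μ ν ((_ , false) ∷ S) (_ ∷ _) _ = refl

<ᵇ-false : ∀ x y → y ≤ x → (x <ᵇ y) ≡ false
<ᵇ-false x       zero    z≤n       = refl
<ᵇ-false (suc x) (suc y) (s≤s y≤x) = <ᵇ-false x y y≤x

<ᵇ-true : ∀ x y → x < y → (x <ᵇ y) ≡ true
<ᵇ-true zero    (suc y) _         = refl
<ᵇ-true (suc x) (suc y) (s≤s x<y) = <ᵇ-true x y x<y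

maxL-< : ∀ c xs → 0 < c → All (_< c) xs → maxL xs < c
maxL-< c []       0<c _             = 0<c
maxL-< c (x ∷ xs) 0<c (x<c ∷ xs<c) = ⊔-pres-<m x<c (maxL-< c xs 0<c xs<c)

maxL-≤ : ∀ c xs → All (_≤ c) xs → maxL xs ≤ c
maxL-≤ c []       _             = z≤n
maxL-≤ c (x ∷ xs) (x≤c ∷ xs≤c) = ⊔-lub x≤c (maxL-≤ c xs xs≤c)

gluedRise-above : ∀ c S σ → 0 < c → All (_< c) σ →
                  gluedRise c S (blockMaxima S σ) ≡ not (gluedHead S) ∧ gluedRise 0 S (blockMaxima S σ)
gluedRise-above c []               σ _   _   = refl
gluedRise-above c ((a , false) ∷ S) σ _   _   = refl
gluedRise-above c ((a , true) ∷ S)  σ 0<c σ<c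
  rewrite <ᵇ-false c (maxL (take a σ)) (<⇒≤ (maxL-< c (take a σ) 0<c (AllP.take⁺ a σ<c))) = refl

take-insertAt-before : ∀ a p c τ → p < suc a → take (suc a) (insertAt p c τ) ≡ insertAt p c (take a τ)
take-insertAt-before a       zero    c τ       _         = refl
take-insertAt-before zero    (suc p) c []      _         = refl
take-insertAt-before (suc a) (suc p) c []      _         = refl
take-insertAt-before zero    (suc p) c (x ∷ τ) (s≤s ())
take-insertAt-before (suc a) (suc p) c (x ∷ τ) (s≤s p<a) = cong (x ∷_) (take-insertAt-before a p c τ p<a)

drop-insertAt-before : ∀ a p c τ → p < suc a → drop (suc a) (insertAt p c τ) ≡ drop a τ
drop-insertAt-before a       zero    c τ       _         = refl
drop-insertAt-before zero    (suc p) c []      _         = refl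
drop-insertAt-before (suc a) (suc p) c []      _         = refl
drop-insertAt-before zero    (suc p) c (x ∷ τ) (s≤s ())
drop-insertAt-before (suc a) (suc p) c (x ∷ τ) (s≤s p<a) = drop-insertAt-before a p c τ p<a

take-insertAt-after : ∀ a q c τ → a ≤ length τ → take a (insertAt (a + q) c τ) ≡ take a τ
take-insertAt-after zero    q c τ       _         = refl
take-insertAt-after (suc a) q c (x ∷ τ) (s≤s a≤τ) = cong (x ∷_) (take-insertAt-after a q c τ a≤τ)

drop-insertAt-after : ∀ a q c τ → a ≤ length τ → drop a (insertAt (a + q) c τ) ≡ insertAt q c (drop a τ)
drop-insertAt-after zero    q c τ       _         = refl
drop-insertAt-after (suc a) q c (x ∷ τ) (s≤s a≤τ) = drop-insertAt-after a q c τ a≤τ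

maxL-insertAt : ∀ p c xs → All (_≤ c) xs → maxL (insertAt p c xs) ≡ c
maxL-insertAt zero    c xs       xs≤c        = m≥n⇒m⊔n≡m (maxL-≤ c xs xs≤c)
maxL-insertAt (suc p) c []       _           = ⊔-identityʳ c
maxL-insertAt (suc p) c (x ∷ xs) (x≤c ∷ xs≤c) = trans (cong (x ⊔_) (maxL-insertAt p c xs xs≤c)) (m≤n⇒m⊔n≡n x≤c)

length-drop-≥ : ∀ a b (τ : List ℕ) → a + b ≤ suc (length τ) → b ≤ suc (length (drop a τ))
length-drop-≥ zero    b       τ       le       = le
length-drop-≥ (suc a) zero    []      _        = z≤n
length-drop-≥ (suc a) (suc b) []      (s≤s le) with () ← subst (_≤ 0) (+-comm a (suc b)) le
length-drop-≥ (suc a) b       (x ∷ τ) (s≤s le) = length-drop-≥ a b τ le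

-- The size of the block containing the current part, before that part:
-- acc if the part is glued to the preceding block, 0 if it starts a new one.
carry : ℕ → Bool → ℕ
carry acc g = if g then acc else 0

-- The effect of deleting the largest letter from part j of S (when part j
-- ends its block; otherwise the next glued part could not exceed it):
-- weight α_j counts the positions inside part j, blockSize is the size of
-- the block up to part j, and residue is S with part j shrunk by one,
-- unglued, and deleted if it becomes empty.
record Removal : Set where
  constructor removal
  field
    weight blockSize : ℕ
    residue          : Flagged
open Removal

shrinkPart : ℕ → Flagged → Flagged
shrinkPart zero          S = S
shrinkPart (suc zero)    S = S
shrinkPart (suc (suc k)) S = (suc k , false) ∷ S

keep : ℕ × Bool → Removal → Removal
keep e (removal w B S) = removal w B (e ∷ S)

-- All removals; acc is the size of the block before the head of S.
removals : ℕ → Flagged → List Removal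
removals acc [] = []
removals acc ((a , g) ∷ S) =
  (if gluedHead S then [] else [ removal a s (shrinkPart a S) ]) ++ map (keep (a , g)) (removals s S)
  where s = carry acc g + a

survives : ℕ → List ℕ → Removal → ℕ
survives μ τ t = weight t * 𝟙 (gluedRise μ (residue t) (blockMaxima (residue t) τ))

-- Inserting c into the head part of S: c becomes that part's maximum, so
-- the head constraint holds and no glued successor can rise above it.
insert-head : ∀ μ c τ a′ g S → μ < c → All (_< c) τ → ∀ p → p < suc a′ →
  gluedRise μ ((suc a′ , g) ∷ S) (blockMaxima ((suc a′ , g) ∷ S) (insertAt p c τ)) ≡
  not (gluedHead S) ∧ gluedRise 0 S (blockMaxima S (drop a′ τ))
insert-head μ c τ a′ g S μ<c τ<c p p<a
  rewrite take-insertAt-before a′ p c τ p<a | drop-insertAt-before a′ p c τ p<a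
        | maxL-insertAt p c (take a′ τ) (All.map <⇒≤ (AllP.take⁺ a′ τ<c))
        | <ᵇ-true μ c μ<c | ∨-zeroʳ (not g)
        | gluedRise-above c S (drop a′ τ) (≤-trans (s≤s z≤n) μ<c) (AllP.drop⁺ a′ τ<c) = refl

insert-tail : ∀ μ c τ a g S q → a ≤ length τ →
  gluedRise μ ((a , g) ∷ S) (blockMaxima ((a , g) ∷ S) (insertAt (a + q) c τ)) ≡
  (not g ∨ (μ <ᵇ maxL (take a τ))) ∧ gluedRise (maxL (take a τ)) S (blockMaxima S (insertAt q c (drop a τ)))
insert-tail μ c τ a g S q a≤τ
  rewrite take-insertAt-after a q c τ a≤τ | drop-insertAt-after a q c τ a≤τ = refl

head-removal : ∀ μ τ a′ acc g S →
  suc a′ * 𝟙 (not (gluedHead S) ∧ gluedRise 0 S (blockMaxima S (drop a′ τ))) ≡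
  ∑ (if gluedHead S then [] else [ removal (suc a′) (carry acc g + suc a′) (shrinkPart (suc a′) S) ])
    (survives μ τ)
head-removal μ τ a′ acc g S with gluedHead S in unglued
... | true = *-zeroʳ (suc a′)
head-removal μ τ zero    acc g S | false =
  trans (cong (λ b → 1 * 𝟙 b) (gluedRise-unglued 0 μ S _ unglued)) (sym (+-identityʳ _))
head-removal μ τ (suc k) acc g S | false =
  trans (cong (λ b → suc (suc k) * 𝟙 b) (gluedRise-unglued 0 (maxL (take (suc k) τ)) S _ unglued))
        (sym (+-identityʳ _))

-- The insertion lemma: summing over all positions of a new largest letter c
-- in τ, the admissible insertions are those into a part ending its block, and
-- they are counted by the removals of S.
insertion-count : ∀ S μ c τ acc → μ < c → All (_< c) τ → Positive S → sum (parts S) ≤ suc (length τ) →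
  ∑< (sum (parts S)) (λ p → 𝟙 (gluedRise μ S (blockMaxima S (insertAt p c τ)))) ≡ ∑ (removals acc S) (survives μ τ)
insertion-count []                  μ c τ acc _   _   _       _   = refl
insertion-count ((suc a′ , g) ∷ S₁) μ c τ acc μ<c τ<c (_ ∷ pos) len = begin
    ∑< (a + sum (parts S₁)) F
  ≡⟨ ∑<-+ a (sum (parts S₁)) F ⟩
    ∑< a F + ∑< (sum (parts S₁)) (λ q → F (a + q))
  ≡⟨ cong₂ _+_ inHead inTail ⟩
    ∑ headRemoval (survives μ τ) + ∑ (map (keep (a , g)) (removals s S₁)) (survives μ τ)
  ≡⟨ sym (∑-++ headRemoval _ (survives μ τ)) ⟩
    ∑ (removals acc ((a , g) ∷ S₁)) (survives μ τ)
  ∎ where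
  open ≡-Reasoning
  a = suc a′
  s = carry acc g + a
  headRemoval = if gluedHead S₁ then [] else [ removal a s (shrinkPart a S₁) ]
  F : ℕ → ℕ
  F p = 𝟙 (gluedRise μ ((a , g) ∷ S₁) (blockMaxima ((a , g) ∷ S₁) (insertAt p c τ)))
  ν = maxL (take a τ)
  rises = not g ∨ (μ <ᵇ ν)
  inHead : ∑< a F ≡ ∑ headRemoval (survives μ τ)
  inHead = trans (∑<-cong a (λ p p<a → cong 𝟙 (insert-head μ c τ a′ g S₁ μ<c τ<c p p<a)))
                 (trans (∑<-const a _) (head-removal μ τ a′ acc g S₁))
  a≤τ : ∀ q → q < sum (parts S₁) → a ≤ length τ
  a≤τ q q<S₁ = m+n≤o⇒m≤o a (s≤s⁻¹ (≤-trans (≤-reflexive (sym (+-suc a q))) (≤-trans (+-monoʳ-≤ a q<S₁) len)))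
  ih = insertion-count S₁ ν c (drop a τ) s (maxL-< c (take a τ) (≤-trans (s≤s z≤n) μ<c) (AllP.take⁺ a τ<c))
         (AllP.drop⁺ a τ<c) pos (length-drop-≥ a (sum (parts S₁)) τ len)
  inTail : ∑< (sum (parts S₁)) (λ q → F (a + q)) ≡ ∑ (map (keep (a , g)) (removals s S₁)) (survives μ τ)
  inTail = begin
      ∑< (sum (parts S₁)) (λ q → F (a + q))
    ≡⟨ ∑<-cong _ (λ q q<S₁ → trans (cong 𝟙 (insert-tail μ c τ a g S₁ q (a≤τ q q<S₁))) (𝟙-∧ rises _)) ⟩
      ∑< (sum (parts S₁)) (λ q → 𝟙 rises * 𝟙 (gluedRise ν S₁ (blockMaxima S₁ (insertAt q c (drop a τ)))))
    ≡⟨ ∑<-*ˡ (sum (parts S₁)) (𝟙 rises) _ ⟩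
      𝟙 rises * ∑< (sum (parts S₁)) (λ q → 𝟙 (gluedRise ν S₁ (blockMaxima S₁ (insertAt q c (drop a τ)))))
    ≡⟨ cong (𝟙 rises *_) ih ⟩
      𝟙 rises * ∑ (removals s S₁) (survives ν (drop a τ))
    ≡⟨ sym (∑-*ˡ (removals s S₁) (𝟙 rises) (survives ν (drop a τ))) ⟩
      ∑ (removals s S₁) (λ t → 𝟙 rises * survives ν (drop a τ) t)
    ≡⟨ ∑-cong (removals s S₁) keep-survives ⟩
      ∑ (removals s S₁) (λ t → survives μ τ (keep (a , g) t))
    ≡⟨ sym (∑-map (keep (a , g)) (removals s S₁) (survives μ τ)) ⟩
      ∑ (map (keep (a , g)) (removals s S₁)) (survives μ τ)
    ∎
    where
    keep-survives : ∀ t → 𝟙 rises * survives ν (drop a τ) t ≡ survives μ τ (keep (a , g) t)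
    keep-survives t = trans (solve 3 (λ r w o → r :* (w :* o) := w :* (r :* o)) refl (𝟙 rises) (weight t) _)
                            (cong (weight t *_) (sym (𝟙-∧ rises _)))

-- πFlag acc S multiplies, over the parts of S, the size of its block up to
-- and including that part; acc is the size of the block before the head.
-- For an unglued S this is π(α, β) (see π-blocks below).
πFlag : ℕ → Flagged → ℕ
πFlag acc []            = 1
πFlag acc ((a , g) ∷ S) = (carry acc g + a) * πFlag (carry acc g + a) S

πFlag-unglued : ∀ x y S → gluedHead S ≡ false → πFlag x S ≡ πFlag y S
πFlag-unglued x y []                _ = refl
πFlag-unglued x y ((a , false) ∷ S) _ = refl

∏ : Flagged → ℕ
∏ S = product (parts S)

record Valid (acc : ℕ) (S : Flagged) (t : Removal) : Set where
  constructor valid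
  field
    size     : suc (sum (parts (residue t))) ≡ sum (parts S)
    positive : Positive (residue t)
    unglued  : gluedHead S ≡ false → gluedHead (residue t) ≡ false
    ratio    : weight t * πFlag acc S * ∏ (residue t) ≡ blockSize t * πFlag acc (residue t) * ∏ S

head-removal-valid : ∀ acc a g S → 0 < a → Positive S →
  All (Valid acc ((a , g) ∷ S)) (if gluedHead S then [] else [ removal a (carry acc g + a) (shrinkPart a S) ])
head-removal-valid acc a g S 0<a pos with gluedHead S in unglued
... | true = []
head-removal-valid acc (suc zero)    g S _ pos | false = valid refl pos (λ _ → unglued) (begin
    1 * (s * πFlag s S) * ∏ S
  ≡⟨ cong (λ u → 1 * (s * u) * ∏ S) (πFlag-unglued s 0 S unglued) ⟩
    1 * (s * πFlag 0 S) * ∏ S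
  ≡⟨ solve 3 (λ x y z → con 1 :* (x :* y) :* z := x :* y :* (con 1 :* z)) refl s (πFlag 0 S) (∏ S) ⟩
    s * πFlag 0 S * (1 * ∏ S)
  ≡⟨ cong (λ v → s * v * (1 * ∏ S)) (sym (πFlag-unglued acc 0 S unglued)) ⟩
    s * πFlag acc S * (1 * ∏ S)
  ∎) ∷ []
  where
  open ≡-Reasoning
  s = carry acc g + 1
head-removal-valid acc (suc (suc k)) g S _ pos | false = valid refl (z<s ∷ pos) (λ _ → refl) (begin
    suc (suc k) * (s * πFlag s S) * (suc k * ∏ S)
  ≡⟨ cong (λ u → suc (suc k) * (s * u) * (suc k * ∏ S)) (πFlag-unglued s 0 S unglued) ⟩
    suc (suc k) * (s * πFlag 0 S) * (suc k * ∏ S)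
  ≡⟨ solve 5 (λ a b x y z → a :* (x :* y) :* (b :* z) := x :* (b :* y) :* (a :* z)) refl
       (suc (suc k)) (suc k) s (πFlag 0 S) (∏ S) ⟩
    s * (suc k * πFlag 0 S) * (suc (suc k) * ∏ S)
  ≡⟨ cong (λ v → s * (suc k * v) * (suc (suc k) * ∏ S)) (sym (πFlag-unglued (suc k) 0 S unglued)) ⟩
    s * (suc k * πFlag (suc k) S) * (suc (suc k) * ∏ S)
  ∎) ∷ []
  where
  open ≡-Reasoning
  s = carry acc g + suc (suc k)

keep-valid : ∀ acc a g S → 0 < a → ∀ {t} → Valid (carry acc g + a) S t → Valid acc ((a , g) ∷ S) (keep (a , g) t)
keep-valid acc a g S 0<a {t} (valid size positive unglued ratio) =
  valid (trans (sym (+-suc a _)) (cong (a +_) size)) (0<a ∷ positive) (λ g≡false → g≡false) (begin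
    weight t * (s * πFlag s S) * (a * ∏ (residue t))
  ≡⟨ solve 5 (λ w x y z u → w :* (x :* y) :* (z :* u) := (x :* z) :* (w :* y :* u)) refl
       (weight t) s (πFlag s S) a (∏ (residue t)) ⟩
    (s * a) * (weight t * πFlag s S * ∏ (residue t))
  ≡⟨ cong ((s * a) *_) ratio ⟩
    (s * a) * (blockSize t * πFlag s (residue t) * ∏ S)
  ≡⟨ solve 5 (λ w x y z u → (x :* z) :* (w :* y :* u) := w :* (x :* y) :* (z :* u)) refl
       (blockSize t) s (πFlag s (residue t)) a (∏ S) ⟩
    blockSize t * (s * πFlag s (residue t)) * (a * ∏ S)
  ∎)
  where
  open ≡-Reasoning
  s = carry acc g + a

removals-valid : ∀ acc S → Positive S → All (Valid acc S) (removals acc S)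
removals-valid acc []             _           = []
removals-valid acc ((a , g) ∷ S) (0<a ∷ pos) = AllP.++⁺ (head-removal-valid acc a g S 0<a pos)
  (AllP.map⁺ (All.map (keep-valid acc a g S 0<a) (removals-valid (carry acc g + a) S pos)))

-- The block sizes of all removals add up to the size of S (plus acc when
-- the head is glued): each block contributes its own size once.
removals-blockSize : ∀ acc a g S → ∑ (removals acc ((a , g) ∷ S)) blockSize ≡ carry acc g + (a + sum (parts S))
removals-blockSize acc a g [] = trans (+-identityʳ _) (cong (carry acc g +_) (sym (+-identityʳ a)))
removals-blockSize acc a g ((a₁ , g₁) ∷ S) with ih ← removals-blockSize (carry acc g + a) a₁ g₁ S | g₁
... | true  = trans (∑-map (keep (a , g)) (removals _ ((a₁ , true) ∷ S)) blockSize)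
                    (trans ih (+-assoc (carry acc g) a _))
... | false = trans (cong (carry acc g + a +_) (trans (∑-map (keep (a , g)) (removals (carry acc g + a) ((a₁ , false) ∷ S)) blockSize) ih))
                    (+-assoc (carry acc g) a _)

count : Flagged → ℕ → ℕ
count S n = ∑ (perms n) (λ σ → 𝟙 (gluedRise 0 S (blockMaxima S σ)))

-- Removing the largest letter n + 1 from a counted permutation.
count-suc : ∀ n S → sum (parts S) ≡ suc n → Positive S →
            count S (suc n) ≡ ∑ (removals 0 S) (λ t → weight t * count (residue t) n)
count-suc n S size pos = begin
    count S (suc n)
  ≡⟨ ∑-perms-suc n f ⟩
    ∑ (perms n) (λ τ → ∑< (suc n) (λ p → f (insertAt p (suc n) τ)))
  ≡⟨ ∑-congAll (perms n) (perms-props n) (λ τ → λ { (len , τ<n+1) →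
        trans (cong (λ N → ∑< N (λ p → f (insertAt p (suc n) τ))) (sym size))
              (insertion-count S 0 (suc n) τ 0 z<s τ<n+1 pos (≤-trans (≤-reflexive size) (s≤s (≤-reflexive (sym len))))) }) ⟩
    ∑ (perms n) (λ τ → ∑ (removals 0 S) (survives 0 τ))
  ≡⟨ ∑-swap (perms n) (removals 0 S) (λ τ t → survives 0 τ t) ⟩
    ∑ (removals 0 S) (λ t → ∑ (perms n) (λ τ → weight t * 𝟙 (gluedRise 0 (residue t) (blockMaxima (residue t) τ))))
  ≡⟨ ∑-cong (removals 0 S) (λ t → ∑-*ˡ (perms n) (weight t) _) ⟩
    ∑ (removals 0 S) (λ t → weight t * count (residue t) n)
  ∎ where
  open ≡-Reasoning
  f : List ℕ → ℕ
  f σ = 𝟙 (gluedRise 0 S (blockMaxima S σ))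

-- The counting theorem: count S n · π(S) = n! · ∏ S, i.e. the proportion of
-- permutations satisfying the glued constraints is ∏ S / π(S).
count-π : ∀ n S → sum (parts S) ≡ n → Positive S → gluedHead S ≡ false → count S n * πFlag 0 S ≡ n ! * ∏ S
count-π zero    []                _  _            _ = refl
count-π zero    ((suc a , g) ∷ S) () _            _
count-π zero    ((zero , g) ∷ S)  _  (() ∷ _)     _
count-π (suc n) []                () _            _
count-π (suc n) ((a , false) ∷ S₁) size pos _ = begin
    count S (suc n) * π
  ≡⟨ cong (_* π) (count-suc n S size pos) ⟩
    ∑ (removals 0 S) (λ t → weight t * count (residue t) n) * π
  ≡⟨ sym (∑-*ʳ (removals 0 S) π _) ⟩
    ∑ (removals 0 S) (λ t → weight t * count (residue t) n * π)
  ≡⟨ ∑-congAll (removals 0 S) (removals-valid 0 S pos) per-removal ⟩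
    ∑ (removals 0 S) (λ t → blockSize t * (n ! * ∏ S))
  ≡⟨ ∑-*ʳ (removals 0 S) (n ! * ∏ S) blockSize ⟩
    ∑ (removals 0 S) blockSize * (n ! * ∏ S)
  ≡⟨ cong (_* (n ! * ∏ S)) (trans (removals-blockSize 0 a false S₁) size) ⟩
    suc n * (n ! * ∏ S)
  ≡⟨ sym (*-assoc (suc n) (n !) (∏ S)) ⟩
    suc n ! * ∏ S
  ∎ where
  open ≡-Reasoning
  S = (a , false) ∷ S₁
  π = πFlag 0 S
  per-removal : ∀ t → Valid 0 S t → weight t * count (residue t) n * π ≡ blockSize t * (n ! * ∏ S)
  per-removal t (valid sz positive unglued ratio) =
    *-cancelʳ-≡ _ _ (∏ (residue t)) {{product≢0 (All.map >-nonZero positive)}} (begin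
      weight t * c * π * ∏ (residue t)
    ≡⟨ solve 4 (λ w p x y → w :* p :* x :* y := p :* (w :* x :* y)) refl (weight t) c π (∏ (residue t)) ⟩
      c * (weight t * π * ∏ (residue t))
    ≡⟨ cong (c *_) ratio ⟩
      c * (blockSize t * πFlag 0 (residue t) * ∏ S)
    ≡⟨ solve 4 (λ p b x q → p :* (b :* x :* q) := b :* q :* (p :* x)) refl c (blockSize t) (πFlag 0 (residue t)) (∏ S) ⟩
      blockSize t * ∏ S * (c * πFlag 0 (residue t))
    ≡⟨ cong (blockSize t * ∏ S *_) (count-π n (residue t) (suc-injective (trans sz size)) positive (unglued refl)) ⟩
      blockSize t * ∏ S * (n ! * ∏ (residue t))
    ≡⟨ solve 4 (λ b q m y → b :* q :* (m :* y) := b :* (m :* q) :* y) refl (blockSize t) (∏ S) (n !) (∏ (residue t)) ⟩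
      blockSize t * (n ! * ∏ S) * ∏ (residue t)
    ∎)
    where c = count (residue t) n

-- All flaggings of the parts of α, and those with unglued head; the latter
-- correspond bijectively to the coarsenings β ≽ α.
flaggings : List ℕ → List Flagged
flaggings []      = [] ∷ []
flaggings (a ∷ α) = concatMap (λ S → ((a , false) ∷ S) ∷ ((a , true) ∷ S) ∷ []) (flaggings α)

coarsenings : List ℕ → List Flagged
coarsenings []      = [] ∷ []
coarsenings (a ∷ α) = map ((a , false) ∷_) (flaggings α)

firstBlock : List (List ℕ) → List ℕ
firstBlock []      = []
firstBlock (b ∷ _) = b

laterBlocks : List (List ℕ) → List (List ℕ)
laterBlocks []       = []
laterBlocks (_ ∷ bs) = bs

toBlocks : Flagged → List (List ℕ)
toBlocks []            = []
toBlocks ((a , _) ∷ S) =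
  (a ∷ (if gluedHead S then firstBlock (toBlocks S) else [])) ∷ (if gluedHead S then laterBlocks (toBlocks S) else toBlocks S)

coarsening : Flagged → List ℕ
coarsening S = map sum (toBlocks S)

-- One unfolding of blockings: its local extension function E (given by its
-- equation on nonempty block lists) puts a new first part either into a block
-- of its own or in front of the first block, i.e. unglued or glued.
private
  blockings-step : ∀ a a′ (E : List (List ℕ) → List (List (List ℕ))) →
    (∀ b bs → E (b ∷ bs) ≡ (((a ∷ []) ∷ b ∷ bs) ∷ ((a ∷ b) ∷ bs) ∷ [])) → ∀ L →
    concatMap E (map toBlocks (map ((a′ , false) ∷_) L)) ≡
    map toBlocks (map ((a , false) ∷_) (concatMap (λ S → ((a′ , false) ∷ S) ∷ ((a′ , true) ∷ S) ∷ []) L))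
  blockings-step a a′ E E-cons []      = refl
  blockings-step a a′ E E-cons (S ∷ L) =
    trans (cong (_++ concatMap E (map toBlocks (map ((a′ , false) ∷_) L))) (E-cons _ _))
          (cong (λ z → _ ∷ _ ∷ z) (blockings-step a a′ E E-cons L))

blockings-coarsenings : ∀ α → blockings α ≡ map toBlocks (coarsenings α)
blockings-coarsenings []           = refl
blockings-coarsenings (a ∷ [])     = refl
blockings-coarsenings (a ∷ a′ ∷ α) =
  trans (cong (concatMap _) (blockings-coarsenings (a′ ∷ α))) (blockings-step a a′ _ (λ b bs → refl) (flaggings α))

πFlag-glued : ∀ a g S acc → πFlag acc ((a , true) ∷ S) ≡
  product (map (acc +_) (partialSums (firstBlock (toBlocks ((a , g) ∷ S))))) * product (map πc (laterBlocks (toBlocks ((a , g) ∷ S))))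

π-blocks : ∀ S → product (map πc (toBlocks S)) ≡ πFlag 0 S

πFlag-glued a g []                 acc = sym (*-identityʳ _)
πFlag-glued a g ((a₁ , true) ∷ S)  acc = begin
    (acc + a) * πFlag (acc + a) ((a₁ , true) ∷ S)
  ≡⟨ cong ((acc + a) *_) (πFlag-glued a₁ true S (acc + a)) ⟩
    (acc + a) * (product (map ((acc + a) +_) ps) * later)
  ≡⟨ sym (*-assoc (acc + a) _ later) ⟩
    (acc + a) * product (map ((acc + a) +_) ps) * later
  ≡⟨ cong (λ z → (acc + a) * product z * later) (trans (ListP.map-cong (+-assoc acc a) ps) (ListP.map-∘ {g = acc +_} {f = a +_} ps)) ⟩
    (acc + a) * product (map (acc +_) (map (a +_) ps)) * later
  ∎ where
  open ≡-Reasoning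
  ps = partialSums (firstBlock (toBlocks ((a₁ , true) ∷ S)))
  later = product (map πc (laterBlocks (toBlocks ((a₁ , true) ∷ S))))
πFlag-glued a g ((a₁ , false) ∷ S) acc = begin
    (acc + a) * πFlag (acc + a) ((a₁ , false) ∷ S)
  ≡⟨ cong ((acc + a) *_) (trans (πFlag-unglued (acc + a) 0 ((a₁ , false) ∷ S) refl) (sym (π-blocks ((a₁ , false) ∷ S)))) ⟩
    (acc + a) * product (map πc (toBlocks ((a₁ , false) ∷ S)))
  ≡⟨ cong (_* product (map πc (toBlocks ((a₁ , false) ∷ S)))) (sym (*-identityʳ (acc + a))) ⟩
    (acc + a) * 1 * product (map πc (toBlocks ((a₁ , false) ∷ S)))
  ∎ where open ≡-Reasoning

π-blocks []            = refl
π-blocks ((a , g) ∷ S) = begin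
    product (map πc (toBlocks ((a , g) ∷ S)))
  ≡⟨ cong (λ z → product z * product (map πc (laterBlocks (toBlocks ((a , g) ∷ S)))))
          (sym (ListP.map-id (partialSums (firstBlock (toBlocks ((a , g) ∷ S)))))) ⟩
    product (map (0 +_) (partialSums (firstBlock (toBlocks ((a , g) ∷ S))))) * product (map πc (laterBlocks (toBlocks ((a , g) ∷ S))))
  ≡⟨ sym (πFlag-glued a g S 0) ⟩
    πFlag 0 ((a , true) ∷ S)
  ≡⟨ head-irrelevant g ⟩
    πFlag 0 ((a , g) ∷ S)
  ∎ where
  open ≡-Reasoning
  head-irrelevant : ∀ g → πFlag 0 ((a , true) ∷ S) ≡ πFlag 0 ((a , g) ∷ S)
  head-irrelevant true  = refl
  head-irrelevant false = refl

flaggings-parts : ∀ α → All (λ S → parts S ≡ α) (flaggings α)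
flaggings-parts []      = refl ∷ []
flaggings-parts (a ∷ α) = AllP.concat⁺ (AllP.map⁺ (All.map (λ e → cong (a ∷_) e ∷ cong (a ∷_) e ∷ []) (flaggings-parts α)))

coarsenings-props : ∀ α → All (λ S → parts S ≡ α × gluedHead S ≡ false) (coarsenings α)
coarsenings-props []      = (refl , refl) ∷ []
coarsenings-props (a ∷ α) = AllP.map⁺ (All.map (λ e → cong (a ∷_) e , refl) (flaggings-parts α))

<ᵇ-suc : ∀ x y → (x <ᵇ suc y) ≡ (x ≤ᵇ y)
<ᵇ-suc zero    y = refl
<ᵇ-suc (suc x) y = refl

weak-step : ∀ x y b → 𝟙 ((x ≤ᵇ y) ∧ (not (x ≡ᵇ y) ∨ b)) ≡ 𝟙 (x <ᵇ y) + 𝟙 (x ≡ᵇ y) * 𝟙 b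
weak-step zero    zero    true  = refl
weak-step zero    zero    false = refl
weak-step zero    (suc y) b     = refl
weak-step (suc x) zero    b     = refl
weak-step (suc x) (suc y) b rewrite <ᵇ-suc x y = weak-step x y b

∑-allFin-suc : ∀ m (h : Fin (suc m) → ℕ) → ∑ (allFin (suc m)) h ≡ h fzero + ∑ (allFin m) (λ i → h (fsuc i))
∑-allFin-suc m h = cong (h fzero +_)
  (trans (cong (λ L → ∑ L h) (sym (ListP.map-tabulate (λ i → i) fsuc))) (∑-map fsuc (allFin m) h))

∑-diagonal : ∀ {m} (i : Fin m) (h : Fin m → ℕ) → ∑ (allFin m) (λ i′ → 𝟙 (toℕ i ≡ᵇ toℕ i′) * h i′) ≡ h i
∑-diagonal {suc m} fzero    h = trans (∑-allFin-suc m (λ i′ → 𝟙 (toℕ (fzero {m}) ≡ᵇ toℕ i′) * h i′))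
  (trans (cong (1 * h fzero +_) (∑-zero (allFin m))) (trans (+-identityʳ _) (*-identityˡ (h fzero))))
∑-diagonal {suc m} (fsuc i) h = trans (∑-allFin-suc m (λ i′ → 𝟙 (toℕ (fsuc i) ≡ᵇ toℕ i′) * h i′)) (∑-diagonal i (λ i′ → h (fsuc i′)))

module _ {m : ℕ} where

  bump : Fin m → ℕ → Vec ℕ m → Vec ℕ m
  bump i a v = updateAt v i (a +_)

  -- Σ_{i_1 < ⋯ < i_r} g(exponent of x_{i_1}^{β_1} ⋯ x_{i_r}^{β_r}); with g the
  -- indicator of a monomial this is its coefficient in M_β.
  ∑strict : List ℕ → (Vec ℕ m → ℕ) → ℕ
  ∑strict β g = ∑ (allSeqs (length β) m) (λ is → 𝟙 (strictInc is) * g (mono is β))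

  ∑strictFrom : Fin m → List ℕ → (Vec ℕ m → ℕ) → ℕ
  ∑strictFrom i []      g = 0
  ∑strictFrom i (b ∷ β) g = ∑ (allSeqs (length β) m) (λ js → 𝟙 (strictInc (i ∷ js)) * g (mono (i ∷ js) (b ∷ β)))

  ∑adm : List ℕ → List ℕ → (Vec ℕ m → ℕ) → ℕ
  ∑adm α M g = ∑ (allSeqs (length α) m) (λ is → 𝟙 (admissible (zip is M)) * g (mono is α))

  ∑admFrom : Fin m → List ℕ → List ℕ → (Vec ℕ m → ℕ) → ℕ
  ∑admFrom i []      M       g = 0
  ∑admFrom i (a ∷ α) []      g = 0
  ∑admFrom i (a ∷ α) (μ ∷ M) g = ∑ (allSeqs (length α) m) (λ is → 𝟙 (admissible (zip (i ∷ is) (μ ∷ M))) * g (mono (i ∷ is) (a ∷ α)))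

  next : Fin m → Bool → (Fin m → ℕ) → ℕ
  next i b h = ∑ (allFin m) (λ i′ → 𝟙 (toℕ i <ᵇ toℕ i′) * h i′) + 𝟙 b * h i

  next-cong : ∀ i b {h h′ : Fin m → ℕ} → (∀ i′ → h i′ ≡ h′ i′) → next i b h ≡ next i b h′
  next-cong i b eq = cong₂ _+_ (∑-cong (allFin m) (λ i′ → cong (𝟙 (toℕ i <ᵇ toℕ i′) *_) (eq i′))) (cong (𝟙 b *_) (eq i))

  ∑-allSeqs-suc : ∀ k (F : List (Fin m) → ℕ) → ∑ (allSeqs (suc k) m) F ≡ ∑ (allFin m) (λ i → ∑ (allSeqs k m) (λ js → F (i ∷ js)))
  ∑-allSeqs-suc k F = trans (∑-concatMap _ (allFin m) F) (∑-cong (allFin m) (λ i → ∑-map (i ∷_) (allSeqs k m) F))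

  ∑strictFrom-step : ∀ i b b′ β g → ∑strictFrom i (b ∷ b′ ∷ β) g ≡
    ∑ (allFin m) (λ i′ → 𝟙 (toℕ i <ᵇ toℕ i′) * ∑strictFrom i′ (b′ ∷ β) (λ v → g (bump i b v)))
  ∑strictFrom-step i b b′ β g = trans (∑-allSeqs-suc (length β) _) (∑-cong (allFin m) (λ i′ →
    ∑-bracket (allSeqs (length β) m) (toℕ i <ᵇ toℕ i′) (λ js → strictInc (i′ ∷ js)) _))

  ∑strictFrom-merge : ∀ i a b β g → ∑strictFrom i ((a + b) ∷ β) g ≡ ∑strictFrom i (b ∷ β) (λ v → g (bump i a v))
  ∑strictFrom-merge i a b β g = ∑-cong (allSeqs (length β) m) (λ js → cong (λ v → 𝟙 (strictInc (i ∷ js)) * g v)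
    (sym (updateAt-updateAt-local i (mono js β) (sym (+-assoc a b _)))))

  ∑admFrom-step : ∀ i a a′ α μ μ′ M g → ∑admFrom i (a ∷ a′ ∷ α) (μ ∷ μ′ ∷ M) g ≡
    next i (μ <ᵇ μ′) (λ i′ → ∑admFrom i′ (a′ ∷ α) (μ′ ∷ M) (λ v → g (bump i a v)))
  ∑admFrom-step i a a′ α μ μ′ M g = begin
      ∑admFrom i (a ∷ a′ ∷ α) (μ ∷ μ′ ∷ M) g
    ≡⟨ ∑-allSeqs-suc (length α) _ ⟩
      ∑ (allFin m) (λ i′ → ∑ (allSeqs (length α) m) (λ js → 𝟙 (step i′ ∧ admissible (zip (i′ ∷ js) (μ′ ∷ M))) * G i′ js))
    ≡⟨ ∑-cong (allFin m) (λ i′ → ∑-bracket (allSeqs (length α) m) (step i′) _ (G i′)) ⟩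
      ∑ (allFin m) (λ i′ → 𝟙 (step i′) * N i′)
    ≡⟨ ∑-cong (allFin m) (λ i′ → trans (cong (_* N i′) (weak-step (toℕ i) (toℕ i′) (μ <ᵇ μ′)))
         (trans (*-distribʳ-+ (N i′) (𝟙 (toℕ i <ᵇ toℕ i′)) _)
           (cong (𝟙 (toℕ i <ᵇ toℕ i′) * N i′ +_) (*-assoc (𝟙 (toℕ i ≡ᵇ toℕ i′)) (𝟙 (μ <ᵇ μ′)) (N i′))))) ⟩
      ∑ (allFin m) (λ i′ → 𝟙 (toℕ i <ᵇ toℕ i′) * N i′ + 𝟙 (toℕ i ≡ᵇ toℕ i′) * (𝟙 (μ <ᵇ μ′) * N i′))
    ≡⟨ ∑-+ (allFin m) _ _ ⟩
      ∑ (allFin m) (λ i′ → 𝟙 (toℕ i <ᵇ toℕ i′) * N i′) + ∑ (allFin m) (λ i′ → 𝟙 (toℕ i ≡ᵇ toℕ i′) * (𝟙 (μ <ᵇ μ′) * N i′))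
    ≡⟨ cong (∑ (allFin m) (λ i′ → 𝟙 (toℕ i <ᵇ toℕ i′) * N i′) +_) (∑-diagonal i (λ i′ → 𝟙 (μ <ᵇ μ′) * N i′)) ⟩
      next i (μ <ᵇ μ′) N
    ∎ where
    open ≡-Reasoning
    step : Fin m → Bool
    step i′ = (toℕ i ≤ᵇ toℕ i′) ∧ (not (toℕ i ≡ᵇ toℕ i′) ∨ (μ <ᵇ μ′))
    G : Fin m → List (Fin m) → ℕ
    G i′ js = g (mono (i ∷ i′ ∷ js) (a ∷ a′ ∷ α))
    N : Fin m → ℕ
    N i′ = ∑admFrom i′ (a′ ∷ α) (μ′ ∷ M) (λ v → g (bump i a v))

  ∑blocksFrom : Fin m → List ℕ → List ℕ → (Vec ℕ m → ℕ) → ℕ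
  ∑blocksFrom i α M g = ∑ (coarsenings α) (λ S → 𝟙 (gluedRise 0 S M) * ∑strictFrom i (coarsening S) g)

  -- The flagging side obeys the same recursion: the second part either starts
  -- a new block (a later index) or is glued to the first (the same index,
  -- allowed only if the maxima rise).
  ∑blocksFrom-step : ∀ i a a′ α μ μ′ M g → ∑blocksFrom i (a ∷ a′ ∷ α) (μ ∷ μ′ ∷ M) g ≡
    next i (μ <ᵇ μ′) (λ i′ → ∑blocksFrom i′ (a′ ∷ α) (μ′ ∷ M) (λ v → g (bump i a v)))
  ∑blocksFrom-step i a a′ α μ μ′ M g = begin
      ∑blocksFrom i (a ∷ a′ ∷ α) (μ ∷ μ′ ∷ M) g
    ≡⟨ ∑-map ((a , false) ∷_) (concatMap (λ S → ((a′ , false) ∷ S) ∷ ((a′ , true) ∷ S) ∷ []) L) F ⟩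
      ∑ (concatMap (λ S → ((a′ , false) ∷ S) ∷ ((a′ , true) ∷ S) ∷ []) L) (λ S → F ((a , false) ∷ S))
    ≡⟨ ∑-concatMap _ L _ ⟩
      ∑ L (λ S → F ((a , false) ∷ (a′ , false) ∷ S) + (F ((a , false) ∷ (a′ , true) ∷ S) + 0))
    ≡⟨ ∑-cong L (λ S → cong₂ _+_ (newBlock S) (glued S)) ⟩
      ∑ L (λ S → o S * ∑ (allFin m) (λ i′ → lt i′ * C i′ S) + 𝟙 (μ <ᵇ μ′) * (o S * C i S))
    ≡⟨ ∑-+ L _ _ ⟩
      ∑ L (λ S → o S * ∑ (allFin m) (λ i′ → lt i′ * C i′ S)) + ∑ L (λ S → 𝟙 (μ <ᵇ μ′) * (o S * C i S))
    ≡⟨ cong₂ _+_ (∑-swap-weighted L (allFin m) o lt (λ S i′ → C i′ S)) (∑-*ˡ L (𝟙 (μ <ᵇ μ′)) _) ⟩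
      next i (μ <ᵇ μ′) (λ i′ → ∑ L (λ S → o S * C i′ S))
    ≡⟨ next-cong i (μ <ᵇ μ′) (λ i′ → sym (∑-map ((a′ , false) ∷_) L _)) ⟩
      next i (μ <ᵇ μ′) (λ i′ → ∑blocksFrom i′ (a′ ∷ α) (μ′ ∷ M) (λ v → g (bump i a v)))
    ∎ where
    open ≡-Reasoning
    L = flaggings α
    F : Flagged → ℕ
    F S = 𝟙 (gluedRise 0 S (μ ∷ μ′ ∷ M)) * ∑strictFrom i (coarsening S) g
    o : Flagged → ℕ
    o S = 𝟙 (gluedRise μ′ S M)
    C : Fin m → Flagged → ℕ
    C i′ S = ∑strictFrom i′ (coarsening ((a′ , false) ∷ S)) (λ v → g (bump i a v))
    lt : Fin m → ℕ
    lt i′ = 𝟙 (toℕ i <ᵇ toℕ i′)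
    newBlock : ∀ S → F ((a , false) ∷ (a′ , false) ∷ S) ≡ o S * ∑ (allFin m) (λ i′ → lt i′ * C i′ S)
    newBlock S = cong (o S *_) (trans (cong (λ x → ∑strictFrom i (x ∷ coarsening ((a′ , false) ∷ S)) g) (+-identityʳ a))
                                      (∑strictFrom-step i a _ _ g))
    glued : ∀ S → F ((a , false) ∷ (a′ , true) ∷ S) + 0 ≡ 𝟙 (μ <ᵇ μ′) * (o S * C i S)
    glued S = trans (+-identityʳ _) (trans (cong₂ _*_ (𝟙-∧ (μ <ᵇ μ′) (gluedRise μ′ S M))
      (∑strictFrom-merge i a (a′ + sum (if gluedHead S then firstBlock (toBlocks S) else []))
                         (map sum (if gluedHead S then laterBlocks (toBlocks S) else toBlocks S)) g))
      (*-assoc (𝟙 (μ <ᵇ μ′)) _ _))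

  -- Grouping equal consecutive indices of an admissible sequence into blocks:
  -- admissible sequences from i correspond to pairs (flagging S whose glued
  -- maxima rise, strictly increasing sequence for β(S) from i).
  ∑admFrom-blocks : ∀ i a α M g → length M ≡ suc (length α) → ∑admFrom i (a ∷ α) M g ≡ ∑blocksFrom i (a ∷ α) M g
  ∑admFrom-blocks i a []       (μ ∷ [])       g _ =
    trans (cong (λ x → 1 * g (bump i x (replicate m 0)) + 0) (sym (+-identityʳ a)))
          (sym (trans (+-identityʳ _) (*-identityˡ _)))
  ∑admFrom-blocks i a (a′ ∷ α) (μ ∷ μ′ ∷ M) g len = begin
      ∑admFrom i (a ∷ a′ ∷ α) (μ ∷ μ′ ∷ M) g
    ≡⟨ ∑admFrom-step i a a′ α μ μ′ M g ⟩
      next i (μ <ᵇ μ′) (λ i′ → ∑admFrom i′ (a′ ∷ α) (μ′ ∷ M) (λ v → g (bump i a v)))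
    ≡⟨ next-cong i (μ <ᵇ μ′) (λ i′ → ∑admFrom-blocks i′ a′ α (μ′ ∷ M) _ (suc-injective len)) ⟩
      next i (μ <ᵇ μ′) (λ i′ → ∑blocksFrom i′ (a′ ∷ α) (μ′ ∷ M) (λ v → g (bump i a v)))
    ≡⟨ sym (∑blocksFrom-step i a a′ α μ μ′ M g) ⟩
      ∑blocksFrom i (a ∷ a′ ∷ α) (μ ∷ μ′ ∷ M) g
    ∎ where open ≡-Reasoning

  ∑strict-cons : ∀ b β g → ∑strict (b ∷ β) g ≡ ∑ (allFin m) (λ i → ∑strictFrom i (b ∷ β) g)
  ∑strict-cons b β g = ∑-allSeqs-suc (length β) _

  ∑adm-blocks : ∀ α M g → length M ≡ length α →
                ∑adm α M g ≡ ∑ (coarsenings α) (λ S → 𝟙 (gluedRise 0 S M) * ∑strict (coarsening S) g)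
  ∑adm-blocks []       M        g _   = sym (trans (+-identityʳ _) (*-identityˡ _))
  ∑adm-blocks (a ∷ α) (μ ∷ M) g len = begin
      ∑adm (a ∷ α) (μ ∷ M) g
    ≡⟨ ∑-allSeqs-suc (length α) _ ⟩
      ∑ (allFin m) (λ i → ∑admFrom i (a ∷ α) (μ ∷ M) g)
    ≡⟨ ∑-cong (allFin m) (λ i → ∑admFrom-blocks i a α (μ ∷ M) g len) ⟩
      ∑ (allFin m) (λ i → ∑ (coarsenings (a ∷ α)) (λ S → rise S * ∑strictFrom i (coarsening S) g))
    ≡⟨ ∑-swap (allFin m) (coarsenings (a ∷ α)) _ ⟩
      ∑ (coarsenings (a ∷ α)) (λ S → ∑ (allFin m) (λ i → rise S * ∑strictFrom i (coarsening S) g))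
    ≡⟨ ∑-cong (coarsenings (a ∷ α)) (λ S → ∑-*ˡ (allFin m) (rise S) _) ⟩
      ∑ (coarsenings (a ∷ α)) (λ S → rise S * ∑ (allFin m) (λ i → ∑strictFrom i (coarsening S) g))
    ≡⟨ ∑-map ((a , false) ∷_) (flaggings α) _ ⟩
      ∑ (flaggings α) (λ S → rise ((a , false) ∷ S) * ∑ (allFin m) (λ i → ∑strictFrom i (coarsening ((a , false) ∷ S)) g))
    ≡⟨ ∑-cong (flaggings α) (λ S → cong (rise ((a , false) ∷ S) *_) (sym (∑strict-cons _ _ g))) ⟩
      ∑ (flaggings α) (λ S → rise ((a , false) ∷ S) * ∑strict (coarsening ((a , false) ∷ S)) g)
    ≡⟨ sym (∑-map ((a , false) ∷_) (flaggings α) _) ⟩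
      ∑ (coarsenings (a ∷ α)) (λ S → rise S * ∑strict (coarsening S) g)
    ∎ where
    open ≡-Reasoning
    rise : Flagged → ℕ
    rise S = 𝟙 (gluedRise 0 S (μ ∷ M))

length-subwords : ∀ α (σ : List ℕ) → length (map maxL (subwords α σ)) ≡ length α
length-subwords []      σ = refl
length-subwords (a ∷ α) σ = cong suc (length-subwords α (drop a σ))

∑perms-adm : ∀ {m} α n (g : Vec ℕ m → ℕ) →
  ∑ (perms n) (λ σ → ∑adm α (map maxL (subwords α σ)) g) ≡ ∑ (coarsenings α) (λ S → count S n * ∑strict (coarsening S) g)
∑perms-adm α n g = begin
    ∑ (perms n) (λ σ → ∑adm α (maxima σ) g)
  ≡⟨ ∑-cong (perms n) (λ σ → ∑adm-blocks α (maxima σ) g (length-subwords α σ)) ⟩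
    ∑ (perms n) (λ σ → ∑ (coarsenings α) (λ S → 𝟙 (gluedRise 0 S (maxima σ)) * ∑strict (coarsening S) g))
  ≡⟨ ∑-swap (perms n) (coarsenings α) _ ⟩
    ∑ (coarsenings α) (λ S → ∑ (perms n) (λ σ → 𝟙 (gluedRise 0 S (maxima σ)) * ∑strict (coarsening S) g))
  ≡⟨ ∑-cong (coarsenings α) (λ S → ∑-*ʳ (perms n) (∑strict (coarsening S) g) _) ⟩
    ∑ (coarsenings α) (λ S → ∑ (perms n) (λ σ → 𝟙 (gluedRise 0 S (maxima σ))) * ∑strict (coarsening S) g)
  ≡⟨ ∑-congAll (coarsenings α) (coarsenings-props α) (λ S (parts≡α , _) →
       cong (_* ∑strict (coarsening S) g)
            (∑-cong (perms n) (λ σ → cong (λ β → 𝟙 (gluedRise 0 S (map maxL (subwords β σ)))) (sym parts≡α)))) ⟩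
    ∑ (coarsenings α) (λ S → count S n * ∑strict (coarsening S) g)
  ∎ where
  open ≡-Reasoning
  maxima : List ℕ → List ℕ
  maxima σ = map maxL (subwords α σ)

product-map-* : ∀ (L : List ℕ) f g → product (map (λ i → f i * g i) L) ≡ product (map f L) * product (map g L)
product-map-* []      f g = refl
product-map-* (x ∷ L) f g = trans (cong (f x * g x *_) (product-map-* L f g))
  (solve 4 (λ a b c d → (a :* b) :* (c :* d) := (a :* c) :* (b :* d)) refl (f x) (g x) (product (map f L)) (product (map g L)))

product-ones : ∀ (L : List ℕ) f → All (λ i → f i ≡ 1) L → product (map f L) ≡ 1
product-ones []      f []            = refl
product-ones (x ∷ L) f (fx≡1 ∷ rest) = cong₂ _*_ fx≡1 (product-ones L f rest)

mult-cons : ∀ i a α → mult i (a ∷ α) ≡ 𝟙 (does (a ≟ i)) + mult i α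
mult-cons i a α with does (a ≟ i)
... | true  = refl
... | false = refl

product-single : ∀ N a → 0 < a → a ≤ N → product (map (λ i → i ^ 𝟙 (does (a ≟ i))) (letters N)) ≡ a
product-single zero    (suc a) _ ()
product-single (suc N) a 0<a a≤N+1 = begin
    product (map F (letters (suc N)))
  ≡⟨ cong (λ L → product (map F L)) (letters-suc N) ⟩
    product (map F (letters N ++ [ suc N ]))
  ≡⟨ cong product (ListP.map-++ F (letters N) [ suc N ]) ⟩
    product (map F (letters N) ++ [ F (suc N) ])
  ≡⟨ product-++ (map F (letters N)) [ F (suc N) ] ⟩
    product (map F (letters N)) * (F (suc N) * 1)
  ≡⟨ last (m≤n⇒m<n∨m≡n a≤N+1) ⟩
    a
  ∎ where
  open ≡-Reasoning
  F : ℕ → ℕ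
  F i = i ^ 𝟙 (does (a ≟ i))
  last : a < suc N ⊎ a ≡ suc N → product (map F (letters N)) * (F (suc N) * 1) ≡ a
  last (inj₁ a<N+1) rewrite dec-false (a ≟ suc N) (<⇒≢ a<N+1) =
    trans (*-identityʳ _) (product-single N a 0<a (s≤s⁻¹ a<N+1))
  last (inj₂ refl) rewrite dec-true (a ≟ suc N) refl =
    trans (cong (_* (suc N * 1 * 1)) (product-ones (letters N) F
            (All.map (λ {i} i<N+1 → cong (i ^_) (cong 𝟙 (dec-false (a ≟ i) (λ a≡i → <-irrefl (sym a≡i) i<N+1)))) (letters-< N))))
          (trans (*-identityˡ _) (trans (*-identityʳ _) (*-identityʳ _)))

product-powers : ∀ N α → All (λ a → 0 < a × a ≤ N) α → product (map (λ i → i ^ mult i α) (letters N)) ≡ product α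
product-powers N []      _                 = product-ones (letters N) _ (All.universal (λ _ → refl) (letters N))
product-powers N (a ∷ α) ((0<a , a≤N) ∷ rest) = begin
    product (map (λ i → i ^ mult i (a ∷ α)) (letters N))
  ≡⟨ cong product (ListP.map-cong (λ i → trans (cong (i ^_) (mult-cons i a α)) (^-distribˡ-+-* i (𝟙 (does (a ≟ i))) (mult i α))) (letters N)) ⟩
    product (map (λ i → i ^ 𝟙 (does (a ≟ i)) * i ^ mult i α) (letters N))
  ≡⟨ product-map-* (letters N) _ _ ⟩
    product (map (λ i → i ^ 𝟙 (does (a ≟ i))) (letters N)) * product (map (λ i → i ^ mult i α) (letters N))
  ≡⟨ cong₂ _*_ (product-single N a 0<a a≤N) (product-powers N α rest) ⟩
    a * product α
  ∎ where open ≡-Reasoning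

parts-bounded : ∀ α → All (λ a → 0 < a) α → All (λ a → 0 < a × a ≤ sum α) α
parts-bounded []      []          = []
parts-bounded (a ∷ α) (0<a ∷ pos) = (0<a , m≤m+n a (sum α)) ∷
  All.map (λ { (0<b , b≤α) → 0<b , ≤-trans b≤α (m≤n+m (sum α) a) }) (parts-bounded α pos)

zee-factor : ∀ α → All (λ a → 0 < a) α → zee α ≡ multFact α * product α
zee-factor α pos = trans (product-map-* (letters (sum α)) (λ i → i ^ mult i α) (λ i → mult i α !))
  (trans (cong (_* multFact α) (product-powers (sum α) α (parts-bounded α pos))) (*-comm (product α) (multFact α)))

private
  fromℚᵘ-+ : ∀ p q → Q.fromℚᵘ (p U.+ q) ≡ Q.fromℚᵘ p Q.+ Q.fromℚᵘ q
  fromℚᵘ-+ p q = QP.toℚᵘ-injective (UP.≃-trans (QP.toℚᵘ-fromℚᵘ (p U.+ q))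
    (UP.≃-trans (UP.+-cong (UP.≃-sym (QP.toℚᵘ-fromℚᵘ p)) (UP.≃-sym (QP.toℚᵘ-fromℚᵘ q)))
                (UP.≃-sym (QP.toℚᵘ-homo-+ (Q.fromℚᵘ p) (Q.fromℚᵘ q)))))

  fromℚᵘ-* : ∀ p q → Q.fromℚᵘ (p U.* q) ≡ Q.fromℚᵘ p Q.* Q.fromℚᵘ q
  fromℚᵘ-* p q = QP.toℚᵘ-injective (UP.≃-trans (QP.toℚᵘ-fromℚᵘ (p U.* q))
    (UP.≃-trans (UP.*-cong (UP.≃-sym (QP.toℚᵘ-fromℚᵘ p)) (UP.≃-sym (QP.toℚᵘ-fromℚᵘ q)))
                (UP.≃-sym (QP.toℚᵘ-homo-* (Q.fromℚᵘ p) (Q.fromℚᵘ q)))))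

ℕ→ℚ-+ : ∀ a b → ℕ→ℚ (a + b) ≡ ℕ→ℚ a Q.+ ℕ→ℚ b
ℕ→ℚ-+ a b = trans (QP.fromℚᵘ-cong {U.mkℚᵘ (ℤ.+ (a + b)) 0} {U.mkℚᵘ (ℤ.+ a) 0 U.+ U.mkℚᵘ (ℤ.+ b) 0}
  (U.*≡* (trans (cong (ℤ._* (ℤ.+ 1 ℤ.* ℤ.+ 1)) (ℤP.pos-+ a b))
    (ℤS.solve 2 (λ x y → (x ℤS.:+ y) ℤS.:* (ℤS.con (ℤ.+ 1) ℤS.:* ℤS.con (ℤ.+ 1)) ℤS.:= (x ℤS.:* ℤS.con (ℤ.+ 1) ℤS.:+ y ℤS.:* ℤS.con (ℤ.+ 1)) ℤS.:* ℤS.con (ℤ.+ 1))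
            refl (ℤ.+ a) (ℤ.+ b)))))
  (fromℚᵘ-+ (U.mkℚᵘ (ℤ.+ a) 0) (U.mkℚᵘ (ℤ.+ b) 0))

ℕ→ℚ-* : ∀ a b → ℕ→ℚ (a * b) ≡ ℕ→ℚ a Q.* ℕ→ℚ b
ℕ→ℚ-* a b = trans (QP.fromℚᵘ-cong {U.mkℚᵘ (ℤ.+ (a * b)) 0} {U.mkℚᵘ (ℤ.+ a) 0 U.* U.mkℚᵘ (ℤ.+ b) 0}
  (U.*≡* (trans (cong (ℤ._* (ℤ.+ 1 ℤ.* ℤ.+ 1)) (ℤP.pos-* a b))
    (ℤS.solve 2 (λ x y → (x ℤS.:* y) ℤS.:* (ℤS.con (ℤ.+ 1) ℤS.:* ℤS.con (ℤ.+ 1)) ℤS.:= (x ℤS.:* y) ℤS.:* ℤS.con (ℤ.+ 1)) refl (ℤ.+ a) (ℤ.+ b)))))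
  (fromℚᵘ-* (U.mkℚᵘ (ℤ.+ a) 0) (U.mkℚᵘ (ℤ.+ b) 0))

ℕ→ℚ-inv : ∀ k → ℕ→ℚ (suc k) Q.* inv (suc k) ≡ Q.1ℚ
ℕ→ℚ-inv k = sym (trans (QP.fromℚᵘ-cong {U.mkℚᵘ (ℤ.+ 1) 0} {U.mkℚᵘ (ℤ.+ suc k) 0 U.* U.mkℚᵘ (ℤ.+ 1) k}
  (U.*≡* (ℤS.solve 1 (λ x → ℤS.con (ℤ.+ 1) ℤS.:* (ℤS.con (ℤ.+ 1) ℤS.:* x) ℤS.:= (x ℤS.:* ℤS.con (ℤ.+ 1)) ℤS.:* ℤS.con (ℤ.+ 1)) refl (ℤ.+ suc k))))
  (fromℚᵘ-* (U.mkℚᵘ (ℤ.+ suc k) 0) (U.mkℚᵘ (ℤ.+ 1) k)))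

fraction-eq : ∀ a b c d → 0 < b → 0 < d → a * d ≡ c * b → ℕ→ℚ a Q.* inv b ≡ ℕ→ℚ c Q.* inv d
fraction-eq a (suc b) c (suc d) _ _ ad≡cb = begin
    x Q.* y
  ≡⟨ sym (trans (cong (x Q.* y Q.*_) (ℕ→ℚ-inv d)) (QP.*-identityʳ (x Q.* y))) ⟩
    x Q.* y Q.* (z Q.* w)
  ≡⟨ ℚS.solve 4 (λ x y z w → x ℚS.:* y ℚS.:* (z ℚS.:* w) ℚS.:= x ℚS.:* z ℚS.:* y ℚS.:* w) refl x y z w ⟩
    x Q.* z Q.* y Q.* w
  ≡⟨ cong (λ u → u Q.* y Q.* w) (trans (sym (ℕ→ℚ-* a (suc d))) (trans (cong ℕ→ℚ ad≡cb) (ℕ→ℚ-* c (suc b)))) ⟩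
    ℕ→ℚ c Q.* ℕ→ℚ (suc b) Q.* y Q.* w
  ≡⟨ cong (Q._* w) (trans (QP.*-assoc (ℕ→ℚ c) (ℕ→ℚ (suc b)) y) (trans (cong (ℕ→ℚ c Q.*_) (ℕ→ℚ-inv b)) (QP.*-identityʳ (ℕ→ℚ c)))) ⟩
    ℕ→ℚ c Q.* w
  ∎ where
  open ≡-Reasoning
  x = ℕ→ℚ a
  y = inv (suc b)
  z = ℕ→ℚ (suc d)
  w = inv (suc d)

∑ℚ : List A → (A → ℚ) → ℚ
∑ℚ []       f = Q.0ℚ
∑ℚ (x ∷ xs) f = f x Q.+ ∑ℚ xs f

∑ℚ-++ : (xs ys : List A) (f : A → ℚ) → ∑ℚ (xs ++ ys) f ≡ ∑ℚ xs f Q.+ ∑ℚ ys f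
∑ℚ-++ []       ys f = sym (QP.+-identityˡ _)
∑ℚ-++ (x ∷ xs) ys f = trans (cong (f x Q.+_) (∑ℚ-++ xs ys f)) (sym (QP.+-assoc (f x) _ _))

∑ℚ-cong : (xs : List A) {f g : A → ℚ} → (∀ x → f x ≡ g x) → ∑ℚ xs f ≡ ∑ℚ xs g
∑ℚ-cong []       eq = refl
∑ℚ-cong (x ∷ xs) eq = cong₂ Q._+_ (eq x) (∑ℚ-cong xs eq)

∑ℚ-congAll : ∀ {P : A → Set} (xs : List A) {f g : A → ℚ} → All P xs → (∀ x → P x → f x ≡ g x) → ∑ℚ xs f ≡ ∑ℚ xs g
∑ℚ-congAll []       []         eq = refl
∑ℚ-congAll (x ∷ xs) (px ∷ pxs) eq = cong₂ Q._+_ (eq x px) (∑ℚ-congAll xs pxs eq)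

∑ℚ-*ˡ : (xs : List A) (c : ℚ) (f : A → ℚ) → c Q.* ∑ℚ xs f ≡ ∑ℚ xs (λ x → c Q.* f x)
∑ℚ-*ˡ []       c f = QP.*-zeroʳ c
∑ℚ-*ˡ (x ∷ xs) c f = trans (QP.*-distribˡ-+ c (f x) _) (cong (c Q.* f x Q.+_) (∑ℚ-*ˡ xs c f))

∑ℚ-map : (g : A → B) (xs : List A) (f : B → ℚ) → ∑ℚ (map g xs) f ≡ ∑ℚ xs (λ x → f (g x))
∑ℚ-map g []       f = refl
∑ℚ-map g (x ∷ xs) f = cong (f (g x) Q.+_) (∑ℚ-map g xs f)

∑ℚ-concatMap : (g : A → List B) (xs : List A) (f : B → ℚ) → ∑ℚ (concatMap g xs) f ≡ ∑ℚ xs (λ x → ∑ℚ (g x) f)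
∑ℚ-concatMap g []       f = refl
∑ℚ-concatMap g (x ∷ xs) f = trans (∑ℚ-++ (g x) (concatMap g xs) f) (cong (∑ℚ (g x) f Q.+_) (∑ℚ-concatMap g xs f))

ℕ→ℚ-∑ : (xs : List A) (f : A → ℕ) → ℕ→ℚ (∑ xs f) ≡ ∑ℚ xs (λ x → ℕ→ℚ (f x))
ℕ→ℚ-∑ []       f = refl
ℕ→ℚ-∑ (x ∷ xs) f = trans (ℕ→ℚ-+ (f x) _) (cong (ℕ→ℚ (f x) Q.+_) (ℕ→ℚ-∑ xs f))

module Coefficient {m : ℕ} (e : Vec ℕ m) where

  isE : Vec ℕ m → Bool
  isE v = does (≡-dec _≟_ v e)

  δ : Vec ℕ m → ℕ
  δ v = 𝟙 (isE v)

  contribution : ℚ × Vec ℕ m → ℚ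
  contribution (c , v) = if isE v then c else Q.0ℚ

  coeff-∑ℚ : (p : Poly m) → coeff p e ≡ ∑ℚ p contribution
  coeff-∑ℚ []            = refl
  coeff-∑ℚ ((c , v) ∷ p) with isE v
  ... | true  = cong (c Q.+_) (coeff-∑ℚ p)
  ... | false = trans (coeff-∑ℚ p) (sym (QP.+-identityˡ _))

  coeff-concatMap : (f : A → Poly m) (xs : List A) → coeff (concatMap f xs) e ≡ ∑ℚ xs (λ x → coeff (f x) e)
  coeff-concatMap f xs = trans (coeff-∑ℚ (concatMap f xs))
    (trans (∑ℚ-concatMap f xs contribution) (∑ℚ-cong xs (λ x → sym (coeff-∑ℚ (f x)))))

  coeff-scale : ∀ c p → coeff (scaleP c p) e ≡ c Q.* coeff p e
  coeff-scale c p = trans (coeff-∑ℚ (scaleP c p)) (trans (∑ℚ-map _ p contribution)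
    (trans (∑ℚ-cong p scaled) (trans (sym (∑ℚ-*ˡ p c contribution)) (cong (c Q.*_) (sym (coeff-∑ℚ p))))))
    where
    scaled : ∀ t → contribution (c Q.* proj₁ t , proj₂ t) ≡ c Q.* contribution t
    scaled (d , v) with isE v
    ... | true  = refl
    ... | false = sym (QP.*-zeroʳ c)

  coeff-selection : (v : A → Vec ℕ m) (bf : A → Bool) (L : List A) →
    coeff (map (λ x → (Q.1ℚ , v x)) (filter (λ x → bf x Bool.≟ true) L)) e ≡ ℕ→ℚ (∑ L (λ x → 𝟙 (bf x) * δ (v x)))
  coeff-selection v bf L = begin
      coeff (map (λ x → (Q.1ℚ , v x)) selected) e
    ≡⟨ coeff-∑ℚ (map (λ x → (Q.1ℚ , v x)) selected) ⟩
      ∑ℚ (map (λ x → (Q.1ℚ , v x)) selected) contribution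
    ≡⟨ ∑ℚ-map _ selected contribution ⟩
      ∑ℚ selected (λ x → contribution (Q.1ℚ , v x))
    ≡⟨ ∑ℚ-cong selected (λ x → unit (v x)) ⟩
      ∑ℚ selected (λ x → ℕ→ℚ (δ (v x)))
    ≡⟨ sym (ℕ→ℚ-∑ selected (λ x → δ (v x))) ⟩
      ℕ→ℚ (∑ selected (λ x → δ (v x)))
    ≡⟨ cong ℕ→ℚ (trans (∑-filter (λ x → bf x Bool.≟ true) L (λ x → δ (v x)))
                       (∑-cong L (λ x → cong (_* δ (v x)) (test (bf x))))) ⟩
      ℕ→ℚ (∑ L (λ x → 𝟙 (bf x) * δ (v x)))
    ∎ where
    open ≡-Reasoning
    selected = filter (λ x → bf x Bool.≟ true) L
    unit : ∀ w → contribution (Q.1ℚ , w) ≡ ℕ→ℚ (δ w)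
    unit w with isE w
    ... | true  = refl
    ... | false = refl
    test : ∀ b → 𝟙 (does (b Bool.≟ true)) ≡ 𝟙 b
    test true  = refl
    test false = refl

factorial-pos : ∀ n → 0 < n !
factorial-pos n = >-nonZero⁻¹ (n !) {{n !≢0}}

πFlag-pos : ∀ acc S → Positive S → 0 < πFlag acc S
πFlag-pos acc []            _           = z<s
πFlag-pos acc ((a , g) ∷ S) (0<a ∷ pos) =
  *-mono-< (<-≤-trans 0<a (m≤n+m a (carry acc g))) (πFlag-pos (carry acc g + a) S pos)

module _ (α : List ℕ) (m : ℕ) (e : Vec ℕ m) where
  open Coefficient e

  ψ-weight : List (List ℕ) → ℚ
  ψ-weight bs = ℕ→ℚ (zee α) Q.* inv (product (map πc bs))

  -- Both sides have coefficient Σ_{β ≽ α} z_α / π(α, β) · [x^e] M_β at x^e.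
  expansion : ℚ
  expansion = ∑ℚ (coarsenings α) (λ S → ψ-weight (toBlocks S) Q.* ℕ→ℚ (∑strict (coarsening S) δ))

  coeff-Psi : coeff (Psi m α) e ≡ expansion
  coeff-Psi = begin
      coeff (Psi m α) e
    ≡⟨ coeff-concatMap _ (blockings α) ⟩
      ∑ℚ (blockings α) (λ bs → coeff (scaleP (ψ-weight bs) (Mpoly m (map sum bs))) e)
    ≡⟨ ∑ℚ-cong (blockings α) (λ bs → trans (coeff-scale (ψ-weight bs) (Mpoly m (map sum bs)))
          (cong (ψ-weight bs Q.*_) (coeff-selection (λ is → mono is (map sum bs)) strictInc (allSeqs (length (map sum bs)) m)))) ⟩
      ∑ℚ (blockings α) (λ bs → ψ-weight bs Q.* ℕ→ℚ (∑strict (map sum bs) δ))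
    ≡⟨ cong (λ L → ∑ℚ L (λ bs → ψ-weight bs Q.* ℕ→ℚ (∑strict (map sum bs) δ))) (blockings-coarsenings α) ⟩
      ∑ℚ (map toBlocks (coarsenings α)) (λ bs → ψ-weight bs Q.* ℕ→ℚ (∑strict (map sum bs) δ))
    ≡⟨ ∑ℚ-map toBlocks (coarsenings α) _ ⟩
      expansion
    ∎ where open ≡-Reasoning

  prefactor : ℚ
  prefactor = ℕ→ℚ (multFact α) Q.* inv (sum α !)

  -- Weighting the permutation count by the prefactor gives z_α / π(α, β):
  -- by the counting theorem and z_α = (∏ m_i(α)!) · ∏ α.
  prefactor-count : All (λ a → 0 < a) α → ∀ S → parts S ≡ α × gluedHead S ≡ false →
                    prefactor Q.* ℕ→ℚ (count S (sum α)) ≡ ψ-weight (toBlocks S)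
  prefactor-count pos S (parts≡α , unglued) = begin
      ℕ→ℚ (multFact α) Q.* inv (n !) Q.* ℕ→ℚ (count S n)
    ≡⟨ trans (QP.*-assoc (ℕ→ℚ (multFact α)) _ _) (trans (cong (ℕ→ℚ (multFact α) Q.*_) (QP.*-comm (inv (n !)) _))
             (sym (QP.*-assoc (ℕ→ℚ (multFact α)) _ _))) ⟩
      ℕ→ℚ (multFact α) Q.* ℕ→ℚ (count S n) Q.* inv (n !)
    ≡⟨ cong (Q._* inv (n !)) (sym (ℕ→ℚ-* (multFact α) (count S n))) ⟩
      ℕ→ℚ (multFact α * count S n) Q.* inv (n !)
    ≡⟨ fraction-eq (multFact α * count S n) (n !) (zee α) (πFlag 0 S) (factorial-pos n) (πFlag-pos 0 S positive) cross ⟩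
      ℕ→ℚ (zee α) Q.* inv (πFlag 0 S)
    ≡⟨ cong (λ u → ℕ→ℚ (zee α) Q.* inv u) (sym (π-blocks S)) ⟩
      ψ-weight (toBlocks S)
    ∎ where
    open ≡-Reasoning
    n = sum α
    positive : Positive S
    positive = subst (All (λ a → 0 < a)) (sym parts≡α) pos
    cross : multFact α * count S n * πFlag 0 S ≡ zee α * n !
    cross = begin
        multFact α * count S n * πFlag 0 S
      ≡⟨ *-assoc (multFact α) _ _ ⟩
        multFact α * (count S n * πFlag 0 S)
      ≡⟨ cong (multFact α *_) (count-π n S (cong sum parts≡α) positive unglued) ⟩
        multFact α * (n ! * product (parts S))
      ≡⟨ cong (λ L → multFact α * (n ! * product L)) parts≡α ⟩
        multFact α * (n ! * product α)
      ≡⟨ solve 3 (λ x y z → x :* (y :* z) := x :* z :* y) refl (multFact α) (n !) (product α) ⟩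
        multFact α * product α * n !
      ≡⟨ cong (_* n !) (sym (zee-factor α pos)) ⟩
        zee α * n !
      ∎

  coeff-RHS : All (λ a → 0 < a) α → coeff (RHS m α) e ≡ expansion
  coeff-RHS pos = begin
      coeff (RHS m α) e
    ≡⟨ coeff-scale prefactor (concatMap admissibleTerms (perms n)) ⟩
      prefactor Q.* coeff (concatMap admissibleTerms (perms n)) e
    ≡⟨ cong (prefactor Q.*_) (coeff-concatMap admissibleTerms (perms n)) ⟩
      prefactor Q.* ∑ℚ (perms n) (λ σ → coeff (admissibleTerms σ) e)
    ≡⟨ cong (prefactor Q.*_) (∑ℚ-cong (perms n) (λ σ →
         coeff-selection (λ is → mono is α) (λ is → admissible (zip is (maxima σ))) (allSeqs (length α) m))) ⟩
      prefactor Q.* ∑ℚ (perms n) (λ σ → ℕ→ℚ (∑adm α (maxima σ) δ))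
    ≡⟨ cong (prefactor Q.*_) (sym (ℕ→ℚ-∑ (perms n) _)) ⟩
      prefactor Q.* ℕ→ℚ (∑ (perms n) (λ σ → ∑adm α (maxima σ) δ))
    ≡⟨ cong (λ u → prefactor Q.* ℕ→ℚ u) (∑perms-adm α n δ) ⟩
      prefactor Q.* ℕ→ℚ (∑ (coarsenings α) (λ S → count S n * ∑strict (coarsening S) δ))
    ≡⟨ trans (cong (prefactor Q.*_) (ℕ→ℚ-∑ (coarsenings α) _)) (∑ℚ-*ˡ (coarsenings α) prefactor _) ⟩
      ∑ℚ (coarsenings α) (λ S → prefactor Q.* ℕ→ℚ (count S n * ∑strict (coarsening S) δ))
    ≡⟨ ∑ℚ-congAll (coarsenings α) (coarsenings-props α) (λ S props →
         trans (cong (prefactor Q.*_) (ℕ→ℚ-* (count S n) _))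
               (trans (sym (QP.*-assoc prefactor _ _)) (cong (Q._* ℕ→ℚ (∑strict (coarsening S) δ)) (prefactor-count pos S props)))) ⟩
      expansion
    ∎ where
    open ≡-Reasoning
    n = sum α
    maxima : List ℕ → List ℕ
    maxima σ = map maxL (subwords α σ)
    admissibleTerms : List ℕ → Poly m
    admissibleTerms σ = map (λ is → (Q.1ℚ , mono is α))
      (filter (λ is → admissible (zip is (maxima σ)) Bool.≟ true) (allSeqs (length α) m))

theorem3p12 : (α : List ℕ) → All (λ a → 0 < a) α → (m : ℕ) → 1 ≤ m →
    Psi m α ≈P RHS m α
theorem3p12 α pos m _ e = trans (coeff-Psi α m e) (sym (coeff-RHS α m e pos))
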